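{- For all $n\ge 1$ and $j\ge 1$, the number of permutations $\sigma\in S_n(231)$ with $\mathrm{des}(\sigma)=j$ and $\mathrm{maxdrop}(\sigma)=j$ equals $\binom{n+j-1}{2j}$. Consequently, the number of permutations $\sigma\in S_n(231)$ with $\mathrm{des}(\sigma)=j$ and $\mathrm{maxdrop}(\sigma)\le j-1$ equals $$\frac{1}{n}\binom{n}{j}\binom{n}{j+1}-\binom{n+j-1}{2j}.$$
   Context: For a permutation $\sigma=\sigma_1\cdots\sigma_n$ of $[n]$, $\mathrm{des}(\sigma)$ is the number of $i\in[n-1]$ with $\sigma_i>\sigma_{i+1}$, and $\mathrm{maxdrop}(\sigma)=\max\{i-\sigma_i : i\in[n]\}$. $S_n(231)$ is the set of permutations of $[n]$ with no indices $a<b<c$ such that $\sigma_c<\sigma_a<\sigma_b$. -}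

module Defs where

open import Data.Nat using (ℕ; zero; suc; _+_; _∸_; _<_; _<ᵇ_; _⊔_)
open import Data.Bool using (if_then_else_)
open import Data.List using (List; []; _∷_; length; lookup; map; upTo)
open import Data.List.Relation.Binary.Permutation.Propositional using (_↭_)
open import Data.List.Relation.Unary.Unique.Propositional using (Unique)
open import Data.List.Membership.Propositional using (_∈_)
open import Data.Fin as Fin using (Fin)
open import Data.Product using (Σ; _×_)
open import Relation.Binary.PropositionalEquality using (_≡_)
open import Relation.Nullary using (¬_)
open import Function.Bundles using (_⇔_)

[1‥_] : ℕ → List ℕ
[1‥ n ] = map suc (upTo n)

-- σ = σ₁ ⋯ σₙ (one-line notation, values in [n]) is a permutation of [n]
IsPerm : ℕ → List ℕ → Set
IsPerm n σ = σ ↭ [1‥ n ]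

Avoids231 : List ℕ → Set
Avoids231 σ = (a b c : Fin (length σ)) → a Fin.< b → b Fin.< c →
  ¬ (lookup σ c < lookup σ a × lookup σ a < lookup σ b)

InS231 : ℕ → List ℕ → Set
InS231 n σ = IsPerm n σ × Avoids231 σ

des : List ℕ → ℕ
des [] = 0
des (x ∷ []) = 0
des (x ∷ y ∷ xs) = (if y <ᵇ x then 1 else 0) + des (y ∷ xs)

maxdropFrom : ℕ → List ℕ → ℕ
maxdropFrom i [] = 0
maxdropFrom i (x ∷ xs) = (i ∸ x) ⊔ maxdropFrom (suc i) xs

maxdrop : List ℕ → ℕ
maxdrop σ = maxdropFrom 1 σ

HasCount : (List ℕ → Set) → ℕ → Set
HasCount P N = Σ (List (List ℕ)) λ xs →
  Unique xs × length xs ≡ N × ((σ : List ℕ) → (σ ∈ xs) ⇔ P σ)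

module Submission where

-- Every σ ∈ S_{m+1}(231) arises in exactly one way by inserting the maximum m+1 into some
-- τ ∈ S_m(231) at a *cut* of τ: a position c such that every entry before it is smaller
-- than every entry after it.
--
-- Each permutation gets a label: des, the number of cuts, whether it is tight
-- (maxdrop = des; maxdrop ≤ des always holds), and the length of the initial run
-- 0, 1, 2, … of cuts.  Inserting at the last cut keeps des and adds a cut; inserting at
-- an inner cut c adds a descent, keeps only the cuts up to c, and keeps tightness iff τ
-- was tight and 0, …, c are all cuts of τ.  Hence the labels of level m are produced by
-- a rewriting rule on labels alone ('labelTree').  Counting labels by statistics gives
-- recurrences solved by binomial coefficients: C(n+j−1, 2j) tight permutations and the
-- Narayana number C(n,j) C(n,j+1) / n of all permutations with j descents.

open import Defs
open import Data.Nat
open import Data.Nat.Properties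
open import Data.Nat.Tactic.RingSolver
open import Data.Nat.Combinatorics using (_C_; nCk+nC[k+1]≡[n+1]C[k+1]; k>n⇒nCk≡0)
open import Data.Bool using (Bool; true; false; T; _∧_; _∨_; if_then_else_; not)
open import Data.Bool.Properties using (∧-zeroʳ; ∧-identityʳ; ∧-comm; ∧-distribˡ-∨)
open import Data.List hiding (find; insertAt; _∷ʳ_)
open import Data.List.Properties
open import Data.List.Relation.Unary.All as All using (All; []; _∷_)
import Data.List.Relation.Unary.All.Properties as AllP
open import Data.List.Relation.Unary.Any using (here; there; index)
open import Data.List.Relation.Unary.Any.Properties using (lookup-index)
open import Data.List.Relation.Unary.AllPairs using ([]; _∷_)
open import Data.List.Relation.Unary.Unique.Propositional using (Unique)
open import Data.List.Relation.Unary.Unique.Propositional.Properties using (upTo⁺; filter⁺; ++⁺; take⁺)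
  renaming (map⁺ to Unique-map⁺)
open import Data.List.Membership.Propositional
open import Data.List.Membership.Propositional.Properties
open import Data.List.Relation.Binary.Sublist.Propositional
  using (_⊆_; []; _∷_; _∷ʳ_; ⊆-refl; ⊆-trans; from∈; to∈)
open import Data.List.Relation.Binary.Sublist.Propositional.Properties using (take-⊆; drop-⊆)
  renaming (++⁺ to ⊆-++⁺)
open import Data.List.Relation.Binary.Permutation.Propositional
  using (_↭_; ↭-refl; ↭-trans; ↭-sym; ↭-reflexive; prep; ↭⇒↭ₛ)
open import Data.List.Relation.Binary.Permutation.Propositional.Properties
  using (∈-resp-↭; shift; ∷↭∷ʳ; drop-mid; ↭-empty-inv; ↭-length)
import Data.Fin as F
open F using (Fin)
open import Data.Product using (Σ; ∃; ∃₂; _×_; _,_; proj₁; proj₂)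
open import Data.Sum using (_⊎_; inj₁; inj₂)
open import Data.Empty
open import Relation.Nullary
open import Relation.Nullary.Decidable using (_×-dec_)
open import Relation.Unary using (Decidable)
open import Relation.Binary.Definitions using (Tri; tri<; tri≈; tri>)
open import Relation.Binary.PropositionalEquality hiding ([_])
open import Data.List.Relation.Binary.Permutation.Setoid.Properties (setoid ℕ) using (Unique-resp-↭)
open import Function using (_∘_)
open import Function.Bundles using (mk⇔)

T⇒≡true : ∀ {b} → T b → b ≡ true
T⇒≡true {true} _ = refl

¬T⇒≡false : ∀ {b} → ¬ T b → b ≡ false
¬T⇒≡false {true} ¬t = ⊥-elim (¬t _)
¬T⇒≡false {false} _ = refl

T-ext : ∀ {a b : Bool} → (T a → T b) → (T b → T a) → a ≡ b
T-ext {false} {false} _ _ = refl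
T-ext {false} {true} _ g = ⊥-elim (g _)
T-ext {true} {false} f _ = ⊥-elim (f _)
T-ext {true} {true} _ _ = refl

T∧ : ∀ {a b} → T a → T b → T (a ∧ b)
T∧ {true} {true} _ _ = _

T∧₁ : ∀ {a b} → T (a ∧ b) → T a
T∧₁ {true} _ = _

T∧₂ : ∀ {a b} → T (a ∧ b) → T b
T∧₂ {true} {true} _ = _

<ᵇ-true : ∀ {a b} → a < b → (a <ᵇ b) ≡ true
<ᵇ-true a<b = T⇒≡true (<⇒<ᵇ a<b)

<ᵇ-false : ∀ {a b} → ¬ a < b → (a <ᵇ b) ≡ false
<ᵇ-false a≮b = ¬T⇒≡false (λ t → a≮b (<ᵇ⇒< _ _ t))

≤ᵇ-true : ∀ {a b} → a ≤ b → (a ≤ᵇ b) ≡ true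
≤ᵇ-true a≤b = T⇒≡true (≤⇒≤ᵇ a≤b)

≤ᵇ-false : ∀ {a b} → ¬ a ≤ b → (a ≤ᵇ b) ≡ false
≤ᵇ-false a≰b = ¬T⇒≡false (λ t → a≰b (≤ᵇ⇒≤ _ _ t))

≡ᵇ-refl : ∀ a → (a ≡ᵇ a) ≡ true
≡ᵇ-refl zero = refl
≡ᵇ-refl (suc a) = ≡ᵇ-refl a

≡ᵇ-false : ∀ {a b} → a ≢ b → (a ≡ᵇ b) ≡ false
≡ᵇ-false a≢b = ¬T⇒≡false (λ t → a≢b (≡ᵇ⇒≡ _ _ t))

-- 231-patterns via sublists.  Avoids231 (from Defs) speaks about indices; for the
-- insertion arguments it is more convenient to forbid a 231-pattern as a sublist.

Is231 : ℕ → ℕ → ℕ → Set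
Is231 x y z = z < x × x < y

Av231 : List ℕ → Set
Av231 σ = ∀ {x y z} → (x ∷ y ∷ z ∷ []) ⊆ σ → ¬ Is231 x y z

lookups⊆₂ : ∀ (σ : List ℕ) (i j : Fin (length σ)) → i F.< j → (lookup σ i ∷ lookup σ j ∷ []) ⊆ σ
lookups⊆₂ (x ∷ σ) F.zero (F.suc j) _ = refl ∷ from∈ (∈-lookup j)
lookups⊆₂ (x ∷ σ) (F.suc i) (F.suc j) (s≤s i<j) = x ∷ʳ lookups⊆₂ σ i j i<j

lookups⊆₃ : ∀ (σ : List ℕ) (i j k : Fin (length σ)) → i F.< j → j F.< k →
  (lookup σ i ∷ lookup σ j ∷ lookup σ k ∷ []) ⊆ σ
lookups⊆₃ (x ∷ σ) F.zero (F.suc j) (F.suc k) _ (s≤s j<k) = refl ∷ lookups⊆₂ σ j k j<k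
lookups⊆₃ (x ∷ σ) (F.suc i) (F.suc j) (F.suc k) (s≤s i<j) (s≤s j<k) = x ∷ʳ lookups⊆₃ σ i j k i<j j<k

⊆-lookups₂ : ∀ {x y : ℕ} {σ} → (x ∷ y ∷ []) ⊆ σ →
  Σ (Fin (length σ)) λ i → Σ (Fin (length σ)) λ j → i F.< j × lookup σ i ≡ x × lookup σ j ≡ y
⊆-lookups₂ (_ ∷ʳ p) with ⊆-lookups₂ p
... | i , j , i<j , eᵢ , eⱼ = F.suc i , F.suc j , s≤s i<j , eᵢ , eⱼ
⊆-lookups₂ (refl ∷ p) = F.zero , F.suc (index (to∈ p)) , s≤s z≤n , refl , sym (lookup-index (to∈ p))

⊆-lookups₃ : ∀ {x y z : ℕ} {σ} → (x ∷ y ∷ z ∷ []) ⊆ σ →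
  Σ (Fin (length σ)) λ i → Σ (Fin (length σ)) λ j → Σ (Fin (length σ)) λ k →
  i F.< j × j F.< k × lookup σ i ≡ x × lookup σ j ≡ y × lookup σ k ≡ z
⊆-lookups₃ (_ ∷ʳ p) with ⊆-lookups₃ p
... | i , j , k , i<j , j<k , eᵢ , eⱼ , eₖ = F.suc i , F.suc j , F.suc k , s≤s i<j , s≤s j<k , eᵢ , eⱼ , eₖ
⊆-lookups₃ (refl ∷ p) with ⊆-lookups₂ p
... | j , k , j<k , eⱼ , eₖ = F.zero , F.suc j , F.suc k , s≤s z≤n , s≤s j<k , refl , eⱼ , eₖ

Av231⇒Avoids231 : ∀ σ → Av231 σ → Avoids231 σ
Av231⇒Avoids231 σ av a b c a<b b<c = av (lookups⊆₃ σ a b c a<b b<c)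

Avoids231⇒Av231 : ∀ σ → Avoids231 σ → Av231 σ
Avoids231⇒Av231 σ av p pat with ⊆-lookups₃ p
... | i , j , k , i<j , j<k , refl , refl , refl = av i j k i<j j<k pat

⊆-split : ∀ {xs} (α β : List ℕ) (n : ℕ) → xs ⊆ α ++ n ∷ β →
  xs ⊆ α ++ β ⊎ ∃₂ λ xs₁ xs₂ → xs ≡ xs₁ ++ n ∷ xs₂ × xs₁ ⊆ α × xs₂ ⊆ β
⊆-split [] β n (_ ∷ʳ p) = inj₁ p
⊆-split [] β n (refl ∷ p) = inj₂ ([] , _ , refl , [] , p)
⊆-split (a ∷ α) β n (_ ∷ʳ p) with ⊆-split α β n p
... | inj₁ q = inj₁ (a ∷ʳ q)
... | inj₂ (xs₁ , xs₂ , e , q₁ , q₂) = inj₂ (xs₁ , xs₂ , e , a ∷ʳ q₁ , q₂)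
⊆-split (a ∷ α) β n (refl ∷ p) with ⊆-split α β n p
... | inj₁ q = inj₁ (refl ∷ q)
... | inj₂ (xs₁ , xs₂ , refl , q₁ , q₂) = inj₂ (a ∷ xs₁ , xs₂ , refl , refl ∷ q₁ , q₂)

⊆-∈ : ∀ {x : ℕ} {xs ys} → xs ⊆ ys → x ∈ xs → x ∈ ys
⊆-∈ p i = to∈ (⊆-trans (from∈ i) p)

insert : ℕ → ℕ → List ℕ → List ℕ
insert c v τ = take c τ ++ v ∷ drop c τ

infix 4 _≺_
_≺_ : List ℕ → List ℕ → Set
α ≺ β = All (λ a → All (a <_) β) α

IsCut : ℕ → List ℕ → Set
IsCut c τ = take c τ ≺ drop c τ

isCut? : ∀ τ c → Dec (IsCut c τ)
isCut? τ c = All.all? (λ a → All.all? (a <?_) (drop c τ)) (take c τ)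

cuts : List ℕ → List ℕ
cuts τ = filter (isCut? τ) (upTo (suc (length τ)))

children : ℕ → List ℕ → List (List ℕ)
children v τ = map (λ c → insert c v τ) (cuts τ)

perms231 : ℕ → List (List ℕ)
perms231 zero = [] ∷ []
perms231 (suc m) = concatMap (children (suc m)) (perms231 m)

Perm231 : ℕ → List ℕ → Set
Perm231 m σ = IsPerm m σ × Av231 σ

[1‥suc]-snoc : ∀ m → [1‥ suc m ] ≡ [1‥ m ] ++ suc m ∷ []
[1‥suc]-snoc m = trans (cong (map suc) (sym (upTo-∷ʳ m))) (map-++ suc (upTo m) (m ∷ []))

∈[1‥]⁻ : ∀ {v m} → v ∈ [1‥ m ] → 1 ≤ v × v ≤ m
∈[1‥]⁻ {v} {m} p with ∈-map⁻ suc p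
... | i , q , refl = s≤s z≤n , ∈-upTo⁻ q

∈[1‥]⁺ : ∀ {v m} → 1 ≤ v → v ≤ m → v ∈ [1‥ m ]
∈[1‥]⁺ {suc v} (s≤s z≤n) le = ∈-map⁺ suc (∈-upTo⁺ le)

perm-unique : ∀ {m σ} → IsPerm m σ → Unique σ
perm-unique {m} perm = Unique-resp-↭ (↭⇒↭ₛ (↭-sym perm)) (Unique-map⁺ suc-injective (upTo⁺ m))

perm-bounded : ∀ {m σ v} → IsPerm m σ → v ∈ σ → v ≤ m
perm-bounded p i = proj₂ (∈[1‥]⁻ (∈-resp-↭ p i))

perm-length : ∀ {m τ} → IsPerm m τ → length τ ≡ m
perm-length {m} perm = trans (↭-length perm) (trans (length-map suc (upTo m)) (length-upTo m))

∈-take : ∀ {a : ℕ} c τ → a ∈ take c τ → a ∈ τ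
∈-take c τ = ⊆-∈ (take-⊆ c τ)

∈-drop : ∀ {a : ℕ} c τ → a ∈ drop c τ → a ∈ τ
∈-drop c τ = ⊆-∈ (drop-⊆ c τ)

take-length-++ : ∀ (α β : List ℕ) → take (length α) (α ++ β) ≡ α
take-length-++ [] β = refl
take-length-++ (a ∷ α) β = cong (a ∷_) (take-length-++ α β)

drop-length-++ : ∀ (α β : List ℕ) → drop (length α) (α ++ β) ≡ β
drop-length-++ [] β = refl
drop-length-++ (a ∷ α) β = drop-length-++ α β

Unique-++-disjoint : ∀ {a b : ℕ} α γ → Unique (α ++ γ) → a ∈ α → b ∈ γ → a ≢ b
Unique-++-disjoint (x ∷ α) γ (ax ∷ u) (here refl) j = All.lookup ax (∈-++⁺ʳ α j)
Unique-++-disjoint (x ∷ α) γ (ax ∷ u) (there i) j = Unique-++-disjoint α γ u i j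

-- Inserting the new maximum at a cut keeps a permutation 231-avoiding: a 231-pattern
-- through m+1 would need an entry before the cut exceeding one after it.
insert-sound : ∀ m τ c → Perm231 m τ → IsCut c τ → Perm231 (suc m) (insert c (suc m) τ)
insert-sound m τ c (perm , av) cut = perm′ , av′
  where
  α : List ℕ
  α = take c τ
  β : List ℕ
  β = drop c τ
  eτ : α ++ β ≡ τ
  eτ = take++drop≡id c τ
  perm′ : insert c (suc m) τ ↭ [1‥ suc m ]
  perm′ = ↭-trans (shift (suc m) α β)
          (↭-trans (subst (λ z → suc m ∷ (α ++ β) ↭ suc m ∷ z) eτ ↭-refl)
          (↭-trans (prep (suc m) perm)
          (↭-trans (∷↭∷ʳ (suc m) [1‥ m ]) (↭-reflexive (sym ([1‥suc]-snoc m))))))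
  below : ∀ {v} → v ∈ τ → v < suc m
  below i = s≤s (perm-bounded perm i)
  av′ : Av231 (insert c (suc m) τ)
  av′ {x} {y} {z} p pat with ⊆-split α β (suc m) p
  ... | inj₁ q = av (subst ((x ∷ y ∷ z ∷ []) ⊆_) eτ q) pat
  av′ p (z<x , x<y) | inj₂ ([] , _ , refl , _ , q₂) =
    <-asym x<y (below (∈-drop c τ (⊆-∈ q₂ (here refl))))
  av′ p (z<x , x<y) | inj₂ (_ ∷ [] , _ , refl , q₁ , q₂) =
    <-asym z<x (All.lookup (All.lookup cut (⊆-∈ q₁ (here refl))) (⊆-∈ q₂ (here refl)))
  av′ p (z<x , x<y) | inj₂ (_ ∷ _ ∷ [] , _ , refl , q₁ , _) =
    <-asym z<x (below (∈-take c τ (⊆-∈ q₁ (here refl))))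
  av′ p pat | inj₂ (_ ∷ _ ∷ _ ∷ [] , _ , () , _ , _)
  av′ p pat | inj₂ (_ ∷ _ ∷ _ ∷ _ ∷ _ , _ , () , _ , _)

-- Conversely, deleting m+1 from σ ∈ S_{m+1}(231) leaves τ ∈ S_m(231), and the position
-- of m+1 is a cut of τ: an entry b after m+1 below an entry a before it gives the
-- pattern a (m+1) b.
insert-complete : ∀ m σ → Perm231 (suc m) σ →
  ∃₂ λ τ c → Perm231 m τ × c ∈ cuts τ × σ ≡ insert c (suc m) τ
insert-complete m σ (perm , av)
  with ∈-∃++ (∈-resp-↭ (↭-sym perm) (∈[1‥]⁺ {suc m} {suc m} (s≤s z≤n) ≤-refl))
... | α , β , refl = α ++ β , length α , (permτ , avτ) , c∈cuts , σ≡
  where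
  n : ℕ
  n = suc m
  permτ : α ++ β ↭ [1‥ m ]
  permτ = subst (α ++ β ↭_) (++-identityʳ _)
            (drop-mid α [1‥ m ] (subst (α ++ [ n ] ++ β ↭_) ([1‥suc]-snoc m) perm))
  avτ : Av231 (α ++ β)
  avτ p = av (⊆-trans p (⊆-++⁺ ⊆-refl (n ∷ʳ ⊆-refl)))
  α≺β : α ≺ β
  α≺β = All.tabulate λ {a} a∈α → All.tabulate λ {b} b∈β →
    let a<n = s≤s (perm-bounded permτ (∈-++⁺ˡ a∈α))
        b≮a = λ b<a → av (⊆-++⁺ (from∈ a∈α) (refl ∷ from∈ b∈β)) (b<a , a<n)
    in ≤∧≢⇒< (≮⇒≥ b≮a)
         (Unique-++-disjoint α (n ∷ β) (perm-unique perm) a∈α (there b∈β))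
  cut : IsCut (length α) (α ++ β)
  cut = subst₂ _≺_ (sym (take-length-++ α β)) (sym (drop-length-++ α β)) α≺β
  c∈cuts : length α ∈ cuts (α ++ β)
  c∈cuts = ∈-filter⁺ (isCut? (α ++ β))
           (∈-upTo⁺ (s≤s (subst (length α ≤_) (sym (length-++ α)) (m≤m+n _ _)))) cut
  σ≡ : α ++ [ n ] ++ β ≡ insert (length α) n (α ++ β)
  σ≡ = sym (cong₂ (λ x y → x ++ n ∷ y) (take-length-++ α β) (drop-length-++ α β))

perms231-sound : ∀ m σ → σ ∈ perms231 m → Perm231 m σ
perms231-sound zero .[] (here refl) = ↭-refl , λ ()
perms231-sound (suc m) σ i with find (∈-concatMap⁻ (children (suc m)) {xs = perms231 m} i)
... | τ , τi , σi with ∈-map⁻ (λ c → insert c (suc m) τ) {xs = cuts τ} σi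
... | c , ci , refl = insert-sound m τ c (perms231-sound m τ τi)
                        (proj₂ (∈-filter⁻ (isCut? τ) {xs = upTo (suc (length τ))} ci))

perms231-complete : ∀ m σ → Perm231 m σ → σ ∈ perms231 m
perms231-complete zero σ (perm , av) with ↭-empty-inv perm
... | refl = here refl
perms231-complete (suc m) σ h with insert-complete m σ h
... | τ , c , hτ , c∈cuts , refl =
  ∈-concatMap⁺ (children (suc m))
    (lose (perms231-complete m τ hτ) (∈-map⁺ (λ c → insert c (suc m) τ) c∈cuts))

-- The enumeration has no repetitions: the new maximum is absent from τ, so the child
-- determines both the parent and the insertion position.

max∉ : ∀ {m τ} → Perm231 m τ → suc m ∉ τ
max∉ (perm , _) i = 1+n≰n (perm-bounded perm i)

-- removing the first occurrence of n undoes inserting n into a list without n, so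
-- inserting a new entry is injective in the list …
remove : ℕ → List ℕ → List ℕ
remove n [] = []
remove n (x ∷ xs) = if x ≡ᵇ n then xs else x ∷ remove n xs

remove-insert : ∀ {n} c τ → n ∉ τ → remove n (insert c n τ) ≡ τ
remove-insert {n} zero τ _ rewrite ≡ᵇ-refl n = refl
remove-insert {n} (suc c) [] _ rewrite ≡ᵇ-refl n = refl
remove-insert {n} (suc c) (x ∷ τ) n∉ rewrite ≡ᵇ-false (λ x≡n → n∉ (here (sym x≡n))) =
  cong (x ∷_) (remove-insert c τ (n∉ ∘ there))

insert-injectiveˡ : ∀ {n} τ τ′ c c′ → n ∉ τ → n ∉ τ′ → insert c n τ ≡ insert c′ n τ′ → τ ≡ τ′
insert-injectiveˡ {n} τ τ′ c c′ n∉τ n∉τ′ e =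
  trans (sym (remove-insert c τ n∉τ)) (trans (cong (remove n) e) (remove-insert c′ τ′ n∉τ′))

insert-injectiveʳ : ∀ {n} τ c c′ → n ∉ τ → c ≤ length τ → c′ ≤ length τ →
  insert c n τ ≡ insert c′ n τ → c ≡ c′
insert-injectiveʳ τ zero zero _ _ _ e = refl
insert-injectiveʳ (x ∷ τ) zero (suc c′) n∉τ _ _ e = ⊥-elim (n∉τ (here (∷-injectiveˡ e)))
insert-injectiveʳ (x ∷ τ) (suc c) zero n∉τ _ _ e = ⊥-elim (n∉τ (here (sym (∷-injectiveˡ e))))
insert-injectiveʳ (x ∷ τ) (suc c) (suc c′) n∉τ (s≤s c≤) (s≤s c′≤) e =
  cong suc (insert-injectiveʳ τ c c′ (n∉τ ∘ there) c≤ c′≤ (∷-injectiveʳ e))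

Unique-map-local : ∀ {A B : Set} (f : A → B) {xs} → Unique xs →
  (∀ {a b} → a ∈ xs → b ∈ xs → f a ≡ f b → a ≡ b) → Unique (map f xs)
Unique-map-local f {[]} u inj = []
Unique-map-local f {x ∷ xs} (x∉xs ∷ u) inj =
  All.tabulate (λ y∈ e → let (a , a∈ , ea) = ∈-map⁻ f y∈ in
                  All.lookup x∉xs a∈ (inj (here refl) (there a∈) (trans e ea)))
  ∷ Unique-map-local f u (λ i j → inj (there i) (there j))

Unique-concatMap : ∀ {A B : Set} (f : A → List B) {xs} → Unique xs →
  (∀ {x} → x ∈ xs → Unique (f x)) →
  (∀ {x y z} → x ∈ xs → y ∈ xs → z ∈ f x → z ∈ f y → x ≡ y) → Unique (concatMap f xs)
Unique-concatMap f {[]} u h d = []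
Unique-concatMap f {x ∷ xs} (x∉xs ∷ u) h d =
  ++⁺ (h (here refl)) (Unique-concatMap f u (h ∘ there) (λ i j → d (there i) (there j)))
    (λ (p , q) → let (y , y∈ , q′) = find (∈-concatMap⁻ f {xs = xs} q) in
        All.lookup x∉xs y∈ (d (here refl) (there y∈) p q′))

cut≤length : ∀ τ {c} → c ∈ cuts τ → c ≤ length τ
cut≤length τ c∈ = ≤-pred (∈-upTo⁻ (proj₁ (∈-filter⁻ (isCut? τ) {xs = upTo (suc (length τ))} c∈)))

perms231-unique : ∀ m → Unique (perms231 m)
perms231-unique zero = [] ∷ []
perms231-unique (suc m) = Unique-concatMap (children (suc m)) (perms231-unique m)
  (λ {τ} τ∈ → Unique-map-local (λ c → insert c (suc m) τ) (filter⁺ (isCut? τ) (upTo⁺ (suc (length τ))))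
     (λ c∈ c′∈ → insert-injectiveʳ τ _ _ (max∉ (perms231-sound m τ τ∈)) (cut≤length τ c∈) (cut≤length τ c′∈)))
  (λ {τ} {τ′} τ∈ τ′∈ σ∈ σ∈′ →
     let (c , _ , e) = ∈-map⁻ (λ c → insert c (suc m) τ) {xs = cuts τ} σ∈
         (c′ , _ , e′) = ∈-map⁻ (λ c → insert c (suc m) τ′) {xs = cuts τ′} σ∈′ in
     insert-injectiveˡ τ τ′ c c′ (max∉ (perms231-sound m τ τ∈)) (max∉ (perms231-sound m τ′ τ′∈))
       (trans (sym e) e′))

-- Inserting m+1 at the cut c of τ keeps exactly the cuts c′ ≤ c of τ,
-- destroys those strictly between c and m (the entry m+1 now sits before them), and
-- creates the new last cut m+1.

take-++-≤ : ∀ c (α γ : List ℕ) → c ≤ length α → take c (α ++ γ) ≡ take c α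
take-++-≤ zero α γ _ = refl
take-++-≤ (suc c) (a ∷ α) γ (s≤s c≤) = cong (a ∷_) (take-++-≤ c α γ c≤)

drop-++-≤ : ∀ c (α γ : List ℕ) → c ≤ length α → drop c (α ++ γ) ≡ drop c α ++ γ
drop-++-≤ zero α γ _ = refl
drop-++-≤ (suc c) (a ∷ α) γ (s≤s c≤) = drop-++-≤ c α γ c≤

take-++-+ : ∀ (α γ : List ℕ) j → take (length α + j) (α ++ γ) ≡ α ++ take j γ
take-++-+ [] γ j = refl
take-++-+ (a ∷ α) γ j = cong (a ∷_) (take-++-+ α γ j)

drop-++-+ : ∀ (α γ : List ℕ) j → drop (length α + j) (α ++ γ) ≡ drop j γ
drop-++-+ [] γ j = refl
drop-++-+ (a ∷ α) γ j = drop-++-+ α γ j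

length-take-≤ : ∀ c (τ : List ℕ) → c ≤ length τ → length (take c τ) ≡ c
length-take-≤ zero τ _ = refl
length-take-≤ (suc c) (x ∷ τ) (s≤s c≤) = cong suc (length-take-≤ c τ c≤)

drop-nonempty : ∀ j (xs : List ℕ) → j < length xs → ∃ λ b → b ∈ drop j xs
drop-nonempty zero (x ∷ xs) _ = x , here refl
drop-nonempty (suc j) (x ∷ xs) (s≤s j<) = drop-nonempty j xs j<

perm-entries< : ∀ {m τ} → IsPerm m τ → All (_< suc m) τ
perm-entries< perm = All.tabulate (λ i → s≤s (perm-bounded perm i))

cut-last : ∀ τ → IsCut (length τ) τ
cut-last τ = subst (take (length τ) τ ≺_) (sym (drop-all (length τ) τ ≤-refl)) (All.tabulate (λ _ → []))

record Site (m : ℕ) (τ : List ℕ) (c : ℕ) : Set where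
  field
    parent : Perm231 m τ
    cut    : IsCut c τ
    c≤m    : c ≤ m
    lenα   : length (take c τ) ≡ c
    eτ     : take c τ ++ drop c τ ≡ τ

mkSite : ∀ {m τ c} → Perm231 m τ → c ∈ cuts τ → Site m τ c
mkSite {m} {τ} {c} h c∈ = record
  { parent = h
  ; cut = proj₂ (∈-filter⁻ (isCut? τ) {xs = upTo (suc (length τ))} c∈)
  ; c≤m = subst (c ≤_) (perm-length (proj₁ h)) (cut≤length τ c∈)
  ; lenα = length-take-≤ c τ (cut≤length τ c∈)
  ; eτ = take++drop≡id c τ }

module CutsOfChild {m τ c} (site : Site m τ c) where
  open Site site
  n : ℕ
  n = suc m
  α : List ℕ
  α = take c τ
  β : List ℕ
  β = drop c τ
  σ : List ℕ
  σ = insert c n τ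

  allα : All (_< n) α
  allα = AllP.++⁻ˡ α (subst (All (_< n)) (sym eτ) (perm-entries< (proj₁ parent)))

  allβ : All (_< n) β
  allβ = AllP.++⁻ʳ α (subst (All (_< n)) (sym eτ) (perm-entries< (proj₁ parent)))

  lenτ : length τ ≡ m
  lenτ = perm-length (proj₁ parent)

  lenβ : length β ≡ m ∸ c
  lenβ = trans (length-drop c τ) (cong (_∸ c) lenτ)

  lenσ : length σ ≡ suc m
  lenσ = perm-length (proj₁ (insert-sound m τ c parent cut))

  module Before {c′} (c′≤c : c′ ≤ c) where
    c′≤α : c′ ≤ length α
    c′≤α = subst (c′ ≤_) (sym lenα) c′≤c

    takeσ : take c′ σ ≡ take c′ α
    takeσ = take-++-≤ c′ α (n ∷ β) c′≤α

    dropσ : drop c′ σ ≡ drop c′ α ++ n ∷ β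
    dropσ = drop-++-≤ c′ α (n ∷ β) c′≤α

    takeτ : take c′ τ ≡ take c′ α
    takeτ = trans (cong (take c′) (sym eτ)) (take-++-≤ c′ α β c′≤α)

    dropτ : drop c′ τ ≡ drop c′ α ++ β
    dropτ = trans (cong (drop c′) (sym eτ)) (drop-++-≤ c′ α β c′≤α)

  cut-before⁺ : ∀ c′ → c′ ≤ c → IsCut c′ τ → IsCut c′ σ
  cut-before⁺ c′ c′≤c ct = subst₂ _≺_ (sym takeσ) (sym dropσ)
    (All.zipWith (λ (p , a<n) → AllP.++⁺ (AllP.++⁻ˡ (drop c′ α) p) (a<n ∷ AllP.++⁻ʳ (drop c′ α) p))
      (subst₂ _≺_ takeτ dropτ ct , All.tabulate (λ i → All.lookup allα (∈-take c′ α i))))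
    where open Before c′≤c

  cut-before⁻ : ∀ c′ → c′ ≤ c → IsCut c′ σ → IsCut c′ τ
  cut-before⁻ c′ c′≤c ct = subst₂ _≺_ (sym takeτ) (sym dropτ)
    (All.map (λ p → AllP.++⁺ (AllP.++⁻ˡ (drop c′ α) p) (All.tail (AllP.++⁻ʳ (drop c′ α) p)))
      (subst₂ _≺_ takeσ dropσ ct))
    where open Before c′≤c

  -- a position c + 1 + j ≤ m has m+1 before it and an entry of β after it
  no-cut-between : ∀ j → c + suc j ≤ m → ¬ IsCut (c + suc j) σ
  no-cut-between j le ct = <-asym (All.lookup n<dropβ b∈) (All.lookup allβ (∈-drop j β b∈))
    where
    pos≡ : c + suc j ≡ length α + suc j
    pos≡ = cong (_+ suc j) (sym lenα)
    takeσ : take (c + suc j) σ ≡ α ++ n ∷ take j β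
    takeσ = trans (cong (λ z → take z σ) pos≡) (take-++-+ α (n ∷ β) (suc j))
    dropσ : drop (c + suc j) σ ≡ drop j β
    dropσ = trans (cong (λ z → drop z σ) pos≡) (drop-++-+ α (n ∷ β) (suc j))
    n<dropβ : All (n <_) (drop j β)
    n<dropβ = All.head (AllP.++⁻ʳ α (subst₂ _≺_ takeσ dropσ ct))
    j<β : j < length β
    j<β = subst (j <_) (sym lenβ) (m+n≤o⇒m≤o∸n (suc j) (subst (_≤ m) (+-comm c (suc j)) le))
    b∈ : proj₁ (drop-nonempty j β j<β) ∈ drop j β
    b∈ = proj₂ (drop-nonempty j β j<β)

Iff : Set → Set → Set
Iff A B = (A → B) × (B → A)

filter-cong-local : ∀ {P Q : ℕ → Set} (P? : Decidable P) (Q? : Decidable Q) xs →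
  (∀ x → x ∈ xs → Iff (P x) (Q x)) → filter P? xs ≡ filter Q? xs
filter-cong-local P? Q? [] h = refl
filter-cong-local P? Q? (x ∷ xs) h with P? x
... | yes px = trans (cong (x ∷_) (filter-cong-local P? Q? xs (λ y i → h y (there i))))
                 (sym (filter-accept Q? (proj₁ (h x (here refl)) px)))
... | no ¬px = trans (filter-cong-local P? Q? xs (λ y i → h y (there i)))
                 (sym (filter-reject Q? (¬px ∘ proj₂ (h x (here refl)))))

filter-upTo-split : ∀ {P Q : ℕ → Set} (P? : Decidable P) (Q? : Decidable Q) c m → c ≤ m →
  (∀ c′ → c′ ≤ c → Iff (P c′) (Q c′)) →
  (∀ j → c + suc j ≤ m → ¬ P (c + suc j)) →
  P (suc m) →
  filter P? (upTo (suc (suc m))) ≡ filter Q? (upTo (suc c)) ++ suc m ∷ []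
filter-upTo-split {P} {Q} P? Q? c m c≤m agree fail last =
  trans (cong (filter P?) (sym (upTo-∷ʳ (suc m))))
  (trans (filter-++ P? (upTo (suc m)) (suc m ∷ []))
  (cong₂ _++_ (subst (λ z → filter P? (upTo z) ≡ filter Q? (upTo (suc c))) e (upTo-c+k (m ∸ c) (≤-reflexive e)))
              (filter-accept P? last)))
  where
  e : suc c + (m ∸ c) ≡ suc m
  e = cong suc (m+[n∸m]≡n c≤m)
  upTo-c+k : ∀ k → suc c + k ≤ suc m → filter P? (upTo (suc c + k)) ≡ filter Q? (upTo (suc c))
  upTo-c+k zero le = subst (λ z → filter P? (upTo z) ≡ filter Q? (upTo (suc c))) (sym (+-identityʳ (suc c)))
    (filter-cong-local P? Q? (upTo (suc c)) (λ x i → agree x (≤-pred (∈-upTo⁻ i))))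
  upTo-c+k (suc k) le =
    trans (cong (λ z → filter P? (upTo z)) (+-suc (suc c) k))
    (trans (cong (filter P?) (sym (upTo-∷ʳ (suc c + k))))
    (trans (filter-++ P? (upTo (suc c + k)) (suc c + k ∷ []))
    (trans (cong (filter P? (upTo (suc c + k)) ++_)
             (filter-reject P? (subst (λ z → ¬ P z) (+-suc c k) (fail k (≤-pred le)))))
    (trans (++-identityʳ _) (upTo-c+k k (≤-trans (n≤1+n _) (subst (λ z → suc z ≤ suc m) (+-suc c k) le)))))))

cuts-child : ∀ {m τ c} → Perm231 m τ → c ∈ cuts τ →
  cuts (insert c (suc m) τ) ≡ filter (isCut? τ) (upTo (suc c)) ++ suc m ∷ []
cuts-child {m} {τ} {c} h c∈ =
  trans (cong (λ z → filter (isCut? σ) (upTo (suc z))) lenσ)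
    (filter-upTo-split (isCut? σ) (isCut? τ) c m c≤m
       (λ c′ le → cut-before⁻ c′ le , cut-before⁺ c′ le) no-cut-between
       (subst (λ z → IsCut z σ) lenσ (cut-last σ)))
  where
  open Site (mkSite h c∈)
  open CutsOfChild (mkSite h c∈)

des-++ : ∀ xs ys → xs ≺ ys → des (xs ++ ys) ≡ des xs + des ys
des-++ [] ys _ = refl
des-++ (x ∷ []) [] _ = refl
des-++ (x ∷ []) (y ∷ ys) ((x<y ∷ _) ∷ []) = cong (λ b → (if b then 1 else 0) + des (y ∷ ys)) (<ᵇ-false (<⇒≯ x<y))
des-++ (x ∷ x′ ∷ xs) ys (_ ∷ xs≺ys) =
  trans (cong ((if x′ <ᵇ x then 1 else 0) +_) (des-++ (x′ ∷ xs) ys xs≺ys))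
        (sym (+-assoc (if x′ <ᵇ x then 1 else 0) (des (x′ ∷ xs)) (des ys)))

des-∷-min : ∀ x xs → All (x <_) xs → des (x ∷ xs) ≡ des xs
des-∷-min x [] _ = refl
des-∷-min x (y ∷ ys) (x<y ∷ _) = cong (λ b → (if b then 1 else 0) + des (y ∷ ys)) (<ᵇ-false (<⇒≯ x<y))

des-peak : ∀ n b β → b < n → des (n ∷ b ∷ β) ≡ suc (des (b ∷ β))
des-peak n b β b<n = cong (λ t → (if t then 1 else 0) + des (b ∷ β)) (<ᵇ-true b<n)

des-∷-mono : ∀ n β → des β ≤ des (n ∷ β)
des-∷-mono n [] = z≤n
des-∷-mono n (b ∷ β) = m≤n+m (des (b ∷ β)) _

maxdropFrom-++ : ∀ i xs ys → maxdropFrom i (xs ++ ys) ≡ maxdropFrom i xs ⊔ maxdropFrom (i + length xs) ys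
maxdropFrom-++ i [] ys = cong (λ z → maxdropFrom z ys) (sym (+-identityʳ i))
maxdropFrom-++ i (x ∷ xs) ys =
  trans (cong ((i ∸ x) ⊔_) (maxdropFrom-++ (suc i) xs ys))
  (trans (sym (⊔-assoc (i ∸ x) (maxdropFrom (suc i) xs) _))
         (cong (λ z → (i ∸ x) ⊔ maxdropFrom (suc i) xs ⊔ maxdropFrom z ys) (sym (+-suc i (length xs)))))

maxdropFrom-shift≤ : ∀ i xs → maxdropFrom (suc i) xs ≤ suc (maxdropFrom i xs)
maxdropFrom-shift≤ i [] = z≤n
maxdropFrom-shift≤ i (x ∷ xs) = ⊔-lub (≤-trans (suc-∸≤ i x) (s≤s (m≤m⊔n _ _)))
                                    (≤-trans (maxdropFrom-shift≤ (suc i) xs) (s≤s (m≤n⊔m _ _)))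
  where
  suc-∸≤ : ∀ i x → suc i ∸ x ≤ suc (i ∸ x)
  suc-∸≤ i zero = ≤-refl
  suc-∸≤ zero (suc x) = ≤-trans (≤-reflexive (0∸n≡0 x)) z≤n
  suc-∸≤ (suc i) (suc x) = suc-∸≤ i x

Drops : ℕ → List ℕ → Set
Drops i [] = ⊥
Drops i (x ∷ xs) = x ≤ i ⊎ Drops (suc i) xs

maxdropFrom-shift : ∀ i xs →
  (maxdropFrom (suc i) xs ≡ suc (maxdropFrom i xs) × Drops i xs)
  ⊎ (maxdropFrom (suc i) xs ≡ 0 × maxdropFrom i xs ≡ 0 × ¬ Drops i xs)
maxdropFrom-shift i [] = inj₂ (refl , refl , λ ())
maxdropFrom-shift i (x ∷ xs) with x ≤? i | maxdropFrom-shift (suc i) xs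
... | yes x≤i | inj₁ (e , _) = inj₁ (cong₂ _⊔_ (+-∸-assoc 1 x≤i) e , inj₁ x≤i)
... | yes x≤i | inj₂ (e₁ , e₂ , _) = inj₁ (trans (cong₂ _⊔_ (+-∸-assoc 1 x≤i) e₁)
       (trans (⊔-identityʳ _) (cong suc (trans (sym (⊔-identityʳ (i ∸ x))) (cong ((i ∸ x) ⊔_) (sym e₂))))) , inj₁ x≤i)
... | no x≰i | inj₁ (e , d) = inj₁ (trans (cong₂ _⊔_ (m≤n⇒m∸n≡0 (≰⇒> x≰i)) e)
       (cong suc (sym (cong (_⊔ maxdropFrom (suc i) xs) (m≤n⇒m∸n≡0 (<⇒≤ (≰⇒> x≰i)))))) , inj₂ d)
... | no x≰i | inj₂ (e₁ , e₂ , ¬d) = inj₂ (cong₂ _⊔_ (m≤n⇒m∸n≡0 (≰⇒> x≰i)) e₁ ,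
       cong₂ _⊔_ (m≤n⇒m∸n≡0 (<⇒≤ (≰⇒> x≰i))) e₂ , λ { (inj₁ x≤i) → x≰i x≤i ; (inj₂ d) → ¬d d })

maxdropFrom-shift-Drops : ∀ i xs → Drops i xs → maxdropFrom (suc i) xs ≡ suc (maxdropFrom i xs)
maxdropFrom-shift-Drops i xs d with maxdropFrom-shift i xs
... | inj₁ (e , _) = e
... | inj₂ (_ , _ , ¬d) = ⊥-elim (¬d d)

-- the last entry of a list of small entries is at most its position
Drops-bounded : ∀ i x xs → All (_≤ i + length xs) (x ∷ xs) → Drops i (x ∷ xs)
Drops-bounded i x [] (x≤ ∷ []) = inj₁ (subst (x ≤_) (+-identityʳ i) x≤)
Drops-bounded i x (y ∷ ys) (_ ∷ bounded) =
  inj₂ (Drops-bounded (suc i) y ys (subst (λ k → All (_≤ k) (y ∷ ys)) (+-suc i (length ys)) bounded))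

des≡0⇒head≤ : ∀ x xs → des (x ∷ xs) ≡ 0 → All (x ≤_) xs
des≡0⇒head≤ x [] _ = []
des≡0⇒head≤ x (y ∷ ys) e with y <ᵇ x in eq
... | false = x≤y ∷ All.map (≤-trans x≤y) (des≡0⇒head≤ y ys e)
  where
  x≤y : x ≤ y
  x≤y = ≮⇒≥ (λ y<x → subst T eq (<⇒<ᵇ y<x))

des≡0⇒tail : ∀ x xs → des (x ∷ xs) ≡ 0 → des xs ≡ 0
des≡0⇒tail x [] _ = refl
des≡0⇒tail x (y ∷ ys) e with y <ᵇ x
... | false = e

sorted⇒all-cuts : ∀ xs → des xs ≡ 0 → Unique xs → ∀ k → IsCut k xs
sorted⇒all-cuts xs _ _ zero = []
sorted⇒all-cuts [] _ _ (suc k) = []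
sorted⇒all-cuts (x ∷ xs) e (x∉xs ∷ u) (suc k) =
  All.tabulate (λ i → ≤∧≢⇒< (All.lookup (des≡0⇒head≤ x xs e) (∈-drop k xs i)) (All.lookup x∉xs (∈-drop k xs i)))
  ∷ sorted⇒all-cuts xs (des≡0⇒tail x xs e) u k

initial-cuts⇒des≡0 : ∀ c τ → (∀ c′ → c′ ≤ c → IsCut c′ τ) → des (take c τ) ≡ 0
initial-cuts⇒des≡0 zero τ _ = refl
initial-cuts⇒des≡0 (suc c) [] _ = refl
initial-cuts⇒des≡0 (suc c) (x ∷ τ) cuts≤ =
  trans (des-∷-min x (take c τ) (All.tabulate (λ i → All.lookup (All.head (cuts≤ 1 (s≤s z≤n))) (∈-take c τ i))))
        (initial-cuts⇒des≡0 c τ (λ c′ c′≤c → All.tail (cuts≤ (suc c′) (s≤s c′≤c))))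

-- The bound maxdrop ≤ des is proved for 231-avoiders together with its analogue for
-- the pieces before and after any cut, which is what survives an insertion.

SuffixBound : List ℕ → Set
SuffixBound τ = ∀ c′ → IsCut c′ τ → c′ ≤ length τ →
  maxdropFrom (suc c′) (drop c′ τ) ≤ des (drop c′ τ)

PrefixBound : List ℕ → Set
PrefixBound τ = ∀ c′ → IsCut c′ τ → c′ ≤ length τ → maxdrop (take c′ τ) ≤ des (take c′ τ)
-- a new largest entry in front of a nonempty list at least pays for the shift
peak-bound : ∀ i n (xs : List ℕ) → All (_< n) xs → maxdropFrom i xs ≤ des xs →
  maxdropFrom (suc i) xs ≤ des (n ∷ xs)
peak-bound i n [] _ _ = z≤n
peak-bound i n (b ∷ xs) (b<n ∷ _) bound =
  ≤-trans (maxdropFrom-shift≤ i (b ∷ xs)) (≤-trans (s≤s bound) (≤-reflexive (sym (des-peak n b xs b<n))))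

⊔-right : ∀ x y z → x ⊔ y ≡ z → x < z → y ≡ z
⊔-right x y z e x<z with ≤-total x y
... | inj₁ x≤y = trans (sym (m≤n⇒m⊔n≡n x≤y)) e
... | inj₂ y≤x = ⊥-elim (<-irrefl (trans (sym (m≥n⇒m⊔n≡m y≤x)) e) x<z)

+≤⇒≡0 : ∀ a b → a + b ≤ b → a ≡ 0
+≤⇒≡0 zero b _ = refl
+≤⇒≡0 (suc a) b le = ⊥-elim (1+n≰n (≤-trans (s≤s (m≤n+m b a)) le))

module StatsOfChild {m τ c} (site : Site m τ c) where
  open Site site
  open CutsOfChild site public

  α≺nβ : α ≺ n ∷ β
  α≺nβ = All.zipWith (λ (a<n , a≺β) → a<n ∷ a≺β) (allα , cut)

  desτ : des τ ≡ des α + des β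
  desτ = trans (cong des (sym eτ)) (des-++ α β cut)

  desσ : des σ ≡ des α + des (n ∷ β)
  desσ = des-++ α (n ∷ β) α≺nβ

  mdτ : maxdrop τ ≡ maxdrop α ⊔ maxdropFrom (suc c) β
  mdτ = trans (cong maxdrop (sym eτ))
          (trans (maxdropFrom-++ 1 α β) (cong (λ z → maxdrop α ⊔ maxdropFrom (suc z) β) lenα))

  -- the entry m+1 at position c+1 has no drop
  mdσ : maxdrop σ ≡ maxdrop α ⊔ maxdropFrom (suc (suc c)) β
  mdσ = trans (maxdropFrom-++ 1 α (n ∷ β))
         (cong (maxdrop α ⊔_) (trans (cong (λ z → maxdropFrom (suc z) (n ∷ β)) lenα)
           (cong (_⊔ maxdropFrom (suc (suc c)) β) (m≤n⇒m∸n≡0 c≤m))))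

  β-last : c ≡ m → β ≡ []
  β-last c≡m = length≡0⇒[] β (trans lenβ (trans (cong (m ∸_) c≡m) (n∸n≡0 m)))
    where
    length≡0⇒[] : ∀ (xs : List ℕ) → length xs ≡ 0 → xs ≡ []
    length≡0⇒[] [] _ = refl

  β-inner : c < m → ∃₂ λ b ys → β ≡ b ∷ ys
  β-inner c<m = length≡suc⇒∷ β (trans lenβ (+-∸-assoc 1 c<m))
    where
    length≡suc⇒∷ : ∀ (xs : List ℕ) {k} → length xs ≡ suc k → ∃₂ λ b ys → xs ≡ b ∷ ys
    length≡suc⇒∷ (x ∷ xs) _ = x , xs , refl

  cut-classify : ∀ c′ → IsCut c′ σ → c′ ≤ suc m → (c′ ≤ c × IsCut c′ τ) ⊎ c′ ≡ suc m
  cut-classify c′ ct c′≤ with c′ ≤? c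
  ... | yes c′≤c = inj₁ (c′≤c , cut-before⁻ c′ c′≤c ct)
  ... | no c′≰c with c′ ≤? m
  ...   | yes c′≤m = ⊥-elim (no-cut-between (c′ ∸ suc c) (subst (_≤ m) (sym e) c′≤m) (subst (λ z → IsCut z σ) (sym e) ct))
    where
    e : c + suc (c′ ∸ suc c) ≡ c′
    e = trans (+-suc c _) (m+[n∸m]≡n (≰⇒> c′≰c))
  ...   | no c′≰m = inj₂ (≤-antisym c′≤ (≰⇒> c′≰m))

  c≤lenτ : c ≤ length τ
  c≤lenτ = subst (c ≤_) (sym lenτ) c≤m

  module Between {c′} (c′≤c : c′ ≤ c) where
    open Before c′≤c public
    δ : List ℕ
    δ = drop c′ α

    pos : suc c′ + length δ ≡ suc c
    pos = trans (cong (suc c′ +_) (trans (length-drop c′ α) (cong (_∸ c′) lenα))) (cong suc (m+[n∸m]≡n c′≤c))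

    mdτ′ : maxdropFrom (suc c′) (drop c′ τ) ≡ maxdropFrom (suc c′) δ ⊔ maxdropFrom (suc c) β
    mdτ′ = trans (cong (maxdropFrom (suc c′)) dropτ)
             (trans (maxdropFrom-++ (suc c′) δ β) (cong (λ z → maxdropFrom (suc c′) δ ⊔ maxdropFrom z β) pos))

    mdσ′ : maxdropFrom (suc c′) (drop c′ σ) ≡ maxdropFrom (suc c′) δ ⊔ maxdropFrom (suc (suc c)) β
    mdσ′ = trans (cong (maxdropFrom (suc c′)) dropσ)
             (trans (maxdropFrom-++ (suc c′) δ (n ∷ β))
               (cong (maxdropFrom (suc c′) δ ⊔_)
                 (trans (cong (λ z → maxdropFrom z (n ∷ β)) pos)
                        (cong (_⊔ maxdropFrom (suc (suc c)) β) (m≤n⇒m∸n≡0 c≤m)))))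

    desτ′ : des (drop c′ τ) ≡ des δ + des β
    desτ′ = trans (cong des dropτ) (des-++ δ β (All.tabulate (λ i → All.lookup cut (∈-drop c′ α i))))

    desσ′ : des (drop c′ σ) ≡ des δ + des (n ∷ β)
    desσ′ = trans (cong des dropσ) (des-++ δ (n ∷ β) (All.tabulate (λ i → All.lookup α≺nβ (∈-drop c′ α i))))

  -- the bound after the cut c′ ≤ c in σ: the bound at c′ in τ controls δ, the one
  -- at c controls β
  suffixBound-child : SuffixBound τ → SuffixBound σ
  suffixBound-child sb c′ ct c′≤ with cut-classify c′ ct (subst (c′ ≤_) lenσ c′≤)
  ... | inj₂ refl = subst (λ z → maxdropFrom (suc (suc m)) z ≤ des z)
                      (sym (drop-all (suc m) σ (≤-reflexive lenσ))) z≤n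
  ... | inj₁ (c′≤c , ct′) = subst₂ _≤_ (sym mdσ′) (sym desσ′) (⊔-lub δ-bound β-bound)
    where
    open Between c′≤c
    δ-bound : maxdropFrom (suc c′) δ ≤ des δ + des (n ∷ β)
    δ-bound = ≤-trans (m≤m⊔n _ _)
                (≤-trans (subst₂ _≤_ mdτ′ desτ′ (sb c′ ct′ (≤-trans c′≤c c≤lenτ)))
                         (+-monoʳ-≤ (des δ) (des-∷-mono n β)))
    β-bound : maxdropFrom (suc (suc c)) β ≤ des δ + des (n ∷ β)
    β-bound = ≤-trans (peak-bound (suc c) n β allβ (sb c cut c≤lenτ)) (m≤n+m _ _)

  prefixBound-child : PrefixBound τ → SuffixBound σ → PrefixBound σ
  prefixBound-child pb sbσ c′ ct c′≤ with cut-classify c′ ct (subst (c′ ≤_) lenσ c′≤)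
  ... | inj₂ refl = subst (λ z → maxdrop z ≤ des z) (sym (take-all (suc m) σ (≤-reflexive lenσ))) (sbσ 0 [] z≤n)
  ... | inj₁ (c′≤c , ct′) = subst (λ z → maxdrop z ≤ des z) (trans takeτ (sym takeσ))
                              (pb c′ ct′ (≤-trans c′≤c c≤lenτ))
    where open Before c′≤c

  des-last : c ≡ m → des σ ≡ des τ
  des-last c≡m = trans desσ (trans (cong (λ z → des α + des (n ∷ z)) (β-last c≡m))
                   (sym (trans desτ (cong (λ z → des α + des z) (β-last c≡m)))))

  maxdrop-last : c ≡ m → maxdrop σ ≡ maxdrop τ
  maxdrop-last c≡m = trans mdσ (trans (cong (λ z → maxdrop α ⊔ maxdropFrom (suc (suc c)) z) (β-last c≡m))
                       (sym (trans mdτ (cong (λ z → maxdrop α ⊔ maxdropFrom (suc c) z) (β-last c≡m)))))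

  -- inserting at an inner cut puts m+1 right before a smaller entry: one new descent
  des-inner : c < m → des σ ≡ suc (des τ)
  des-inner c<m with β-inner c<m
  ... | b , ys , β≡ = trans desσ (trans (cong (des α +_) desnβ) (trans (+-suc (des α) (des β)) (cong suc (sym desτ))))
    where
    desnβ : des (n ∷ β) ≡ suc (des β)
    desnβ = subst (λ z → des (n ∷ z) ≡ suc (des z)) (sym β≡)
              (des-peak n b ys (All.head (subst (All (_< n)) β≡ allβ)))

  -- after an inner cut, β ends at position m with an entry ≤ m
  β-drops : c < m → Drops (suc c) β
  β-drops c<m with β-inner c<m
  ... | b , ys , β≡ = subst (Drops (suc c)) (sym β≡)
                        (Drops-bounded (suc c) b ys (subst (All (_≤ suc c + length ys)) β≡ bounded))
    where
    len : suc c + length ys ≡ m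
    len = trans (sym (+-suc c (length ys))) (trans (cong (c +_) (trans (cong length (sym β≡)) lenβ)) (m+[n∸m]≡n c≤m))
    bounded : All (_≤ suc c + length ys) β
    bounded = All.map (λ v<n → subst (_ ≤_) (sym len) (≤-pred v<n)) allβ

  -- The new descent must be paid for by the drops of β, which gain one
  -- by the shift; this forces α to be increasing and drop-free.
  module Inner (c<m : c < m) (pb : PrefixBound τ) (sb : SuffixBound τ) where
    mdα≤ : maxdrop α ≤ des α
    mdα≤ = pb c cut c≤lenτ

    mdβ≤ : maxdropFrom (suc c) β ≤ des β
    mdβ≤ = sb c cut c≤lenτ

    tight⇒ : maxdrop σ ≡ des σ → maxdrop τ ≡ des τ × (∀ c′ → c′ ≤ c → IsCut c′ τ)
    tight⇒ tight = mdτ≡desτ , initial-cuts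
      where
      e₁ : maxdrop α ⊔ maxdropFrom (suc (suc c)) β ≡ suc (des α + des β)
      e₁ = trans (sym mdσ) (trans tight (trans (des-inner c<m) (cong suc desτ)))
      eβ : maxdropFrom (suc (suc c)) β ≡ suc (des α + des β)
      eβ = ⊔-right _ _ _ e₁ (s≤s (≤-trans mdα≤ (m≤m+n _ _)))
      desα≡0 : des α ≡ 0
      desα≡0 = +≤⇒≡0 (des α) (des β)
                 (≤-pred (≤-trans (≤-reflexive (sym eβ)) (≤-trans (maxdropFrom-shift≤ (suc c) β) (s≤s mdβ≤))))
      mdα≡0 : maxdrop α ≡ 0
      mdα≡0 = n≤0⇒n≡0 (subst (maxdrop α ≤_) desα≡0 mdα≤)
      desβ≤ : des β ≤ maxdropFrom (suc c) β
      desβ≤ = ≤-pred (≤-trans (≤-reflexive (sym (trans eβ (cong (λ z → suc (z + des β)) desα≡0))))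
                                (maxdropFrom-shift≤ (suc c) β))
      mdτ≡desτ : maxdrop τ ≡ des τ
      mdτ≡desτ = trans mdτ (trans (cong (_⊔ maxdropFrom (suc c) β) mdα≡0)
                   (trans (≤-antisym mdβ≤ desβ≤) (sym (trans desτ (cong (_+ des β) desα≡0)))))
      initial-cuts : ∀ c′ → c′ ≤ c → IsCut c′ τ
      initial-cuts c′ c′≤c = subst₂ _≺_ (sym takeτ) (sym dropτ)
        (All.zipWith (λ (p , q) → AllP.++⁺ p q)
          (sorted⇒all-cuts α desα≡0 (take⁺ c (perm-unique (proj₁ parent))) c′ ,
           All.tabulate (λ i → All.lookup cut (∈-take c′ α i))))
        where open Before c′≤c

    tight⇐ : maxdrop τ ≡ des τ × (∀ c′ → c′ ≤ c → IsCut c′ τ) → maxdrop σ ≡ des σ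
    tight⇐ (tight , initial-cuts) =
      trans mdσ (trans (cong₂ _⊔_ mdα≡0 eβ) (sym (trans (des-inner c<m) (cong suc (trans desτ (cong (_+ des β) desα≡0))))))
      where
      desα≡0 : des α ≡ 0
      desα≡0 = initial-cuts⇒des≡0 c τ initial-cuts
      mdα≡0 : maxdrop α ≡ 0
      mdα≡0 = n≤0⇒n≡0 (subst (maxdrop α ≤_) desα≡0 mdα≤)
      mdβ≡ : maxdropFrom (suc c) β ≡ des β
      mdβ≡ = trans (sym (cong (_⊔ maxdropFrom (suc c) β) mdα≡0))
               (trans (sym mdτ) (trans tight (trans desτ (cong (_+ des β) desα≡0))))
      eβ : maxdropFrom (suc (suc c)) β ≡ suc (des β)
      eβ = trans (maxdropFrom-shift-Drops (suc c) β (β-drops c<m)) (cong suc mdβ≡)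

perms231-bounds : ∀ m τ → τ ∈ perms231 m → PrefixBound τ × SuffixBound τ
perms231-bounds zero .[] (here refl) = (λ { _ _ z≤n → z≤n }) , (λ { _ _ z≤n → z≤n })
perms231-bounds (suc m) σ σ∈ with find (∈-concatMap⁻ (children (suc m)) {xs = perms231 m} σ∈)
... | τ , τ∈ , σ∈′ with ∈-map⁻ (λ c → insert c (suc m) τ) {xs = cuts τ} σ∈′
... | c , c∈ , refl with perms231-bounds m τ τ∈
... | pb , sb = prefixBound-child pb (suffixBound-child sb) , suffixBound-child sb
  where open StatsOfChild (mkSite (perms231-sound m τ τ∈) c∈)

maxdrop≤des : ∀ m τ → τ ∈ perms231 m → maxdrop τ ≤ des τ
maxdrop≤des m τ τ∈ = proj₂ (perms231-bounds m τ τ∈) 0 [] z≤n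

-- The initial run of a list: how many leading entries equal j, j+1, j+2, ….  Applied to
-- the cuts of τ, run counts the leading cuts 0, 1, 2, ….

runFrom : ℕ → List ℕ → ℕ
runFrom j [] = 0
runFrom j (x ∷ xs) = if x ≡ᵇ j then suc (runFrom (suc j) xs) else 0

run : List ℕ → ℕ
run = runFrom 0

runFrom≤length : ∀ j xs → runFrom j xs ≤ length xs
runFrom≤length j [] = z≤n
runFrom≤length j (x ∷ xs) with x ≡ᵇ j
... | true = s≤s (runFrom≤length (suc j) xs)
... | false = z≤n

applyUpTo-cong : ∀ {f g : ℕ → ℕ} k → (∀ x → f x ≡ g x) → applyUpTo f k ≡ applyUpTo g k
applyUpTo-cong zero _ = refl
applyUpTo-cong (suc k) f≗g = cong₂ _∷_ (f≗g 0) (applyUpTo-cong k (λ x → f≗g (suc x)))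

runFrom-full : ∀ j xs → runFrom j xs ≡ length xs → xs ≡ applyUpTo (j +_) (length xs)
runFrom-full j [] _ = refl
runFrom-full j (x ∷ xs) e with x ≡ᵇ j in eq
... | true = cong₂ _∷_ (trans (≡ᵇ⇒≡ x j (subst T (sym eq) _)) (sym (+-identityʳ j)))
               (trans (runFrom-full (suc j) xs (suc-injective e))
                      (applyUpTo-cong (length xs) (λ x → sym (+-suc j x))))

runFrom-applyUpTo : ∀ j k → runFrom j (applyUpTo (j +_) k) ≡ k
runFrom-applyUpTo j zero = refl
runFrom-applyUpTo j (suc k) rewrite +-identityʳ j | ≡ᵇ-refl j =
  cong suc (trans (cong (runFrom (suc j)) (applyUpTo-cong k (λ x → +-suc j x))) (runFrom-applyUpTo (suc j) k))

runFrom-++-short : ∀ j xs ys → runFrom j xs < length xs → runFrom j (xs ++ ys) ≡ runFrom j xs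
runFrom-++-short j (x ∷ xs) ys lt with x ≡ᵇ j
... | true = cong suc (runFrom-++-short (suc j) xs ys (≤-pred lt))
... | false = refl

runFrom-++-full : ∀ j xs ys → runFrom j xs ≡ length xs →
  runFrom j (xs ++ ys) ≡ length xs + runFrom (j + length xs) ys
runFrom-++-full j [] ys _ = cong (λ z → runFrom z ys) (sym (+-identityʳ j))
runFrom-++-full j (x ∷ xs) ys e with x ≡ᵇ j
... | true = cong suc (trans (runFrom-++-full (suc j) xs ys (suc-injective e))
                        (cong (λ z → length xs + runFrom z ys) (sym (+-suc j (length xs)))))

module FilteredRange {P : ℕ → Set} (P? : Decidable P) where
  sel : ℕ → List ℕ
  sel M = filter P? (upTo M)

  sel-suc : ∀ M → sel (suc M) ≡ sel M ++ filter P? (M ∷ [])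
  sel-suc M = trans (cong (filter P?) (sym (upTo-∷ʳ M))) (filter-++ P? (upTo M) (M ∷ []))

  sel-suc-yes : ∀ M → P M → sel (suc M) ≡ sel M ++ M ∷ []
  sel-suc-yes M p = trans (sel-suc M) (cong (sel M ++_) (filter-accept P? p))

  sel-suc-no : ∀ M → ¬ P M → sel (suc M) ≡ sel M
  sel-suc-no M ¬p = trans (sel-suc M) (trans (cong (sel M ++_) (filter-reject P? ¬p)) (++-identityʳ _))

  length-sel≤ : ∀ M → length (sel M) ≤ M
  length-sel≤ M = ≤-trans (length-filter P? (upTo M)) (≤-reflexive (length-upTo M))

  sel-ranks : ∀ M → map (λ c → length (sel (suc c))) (sel M) ≡ map suc (upTo (length (sel M)))
  sel-ranks zero = refl
  sel-ranks (suc M) with P? M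
  ... | yes p = begin
      map rank (sel (suc M))
        ≡⟨ cong (map rank) (sel-suc-yes M p) ⟩
      map rank (sel M ++ M ∷ [])
        ≡⟨ map-++ rank (sel M) (M ∷ []) ⟩
      map rank (sel M) ++ rank M ∷ []
        ≡⟨ cong₂ (λ a b → a ++ b ∷ []) (sel-ranks M) length-sel-suc ⟩
      map suc (upTo L) ++ suc L ∷ []
        ≡⟨ sym (map-++ suc (upTo L) (L ∷ [])) ⟩
      map suc (upTo L ++ L ∷ [])
        ≡⟨ cong (map suc) (upTo-∷ʳ L) ⟩
      map suc (upTo (suc L))
        ≡⟨ cong (λ z → map suc (upTo z)) (sym length-sel-suc) ⟩
      map suc (upTo (length (sel (suc M)))) ∎
    where
    open ≡-Reasoning
    rank : ℕ → ℕ
    rank = λ c → length (sel (suc c))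
    L : ℕ
    L = length (sel M)
    length-sel-suc : length (sel (suc M)) ≡ suc L
    length-sel-suc = trans (cong length (sel-suc-yes M p)) (trans (length-++ (sel M)) (+-comm L 1))
  ... | no ¬p = trans (cong (map (λ c → length (sel (suc c)))) (sel-suc-no M ¬p))
                  (trans (sel-ranks M) (cong (λ z → map suc (upTo z)) (sym (cong length (sel-suc-no M ¬p)))))

  sel-full⇒all : ∀ M → length (sel M) ≡ M → ∀ c′ → c′ < M → P c′
  sel-full⇒all M e c′ c′<M = proj₂ (∈-filter⁻ P? {xs = upTo M}
    (subst (c′ ∈_) (sym (filter-complete P? (trans e (sym (length-upTo M))))) (∈-upTo⁺ c′<M)))

  all⇒sel-full : ∀ M → (∀ c′ → c′ < M → P c′) → sel M ≡ upTo M
  all⇒sel-full M all = filter-all P? (All.tabulate (λ i → all _ (∈-upTo⁻ i)))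

  sel-prefix : ∀ M k → ∃ λ R → sel (M + k) ≡ sel M ++ R
  sel-prefix M zero = [] , trans (cong sel (+-identityʳ M)) (sym (++-identityʳ _))
  sel-prefix M (suc k) with sel-prefix M k
  ... | R , e = R ++ filter P? (M + k ∷ []) ,
      trans (cong sel (+-suc M k)) (trans (sel-suc (M + k)) (trans (cong (_++ filter P? (M + k ∷ [])) e) (++-assoc (sel M) R _)))

  -- Inserting at the selected position c < m keeps the selected positions up to c and
  -- appends m+1.  With i = #selected positions ≤ c and A = run of all selected ones:
  -- 0, …, c are all selected iff i ≤ A, and the new run is min(i, A).
  module InnerRun (c m : ℕ) (c<m : c < m) (pc : P c) where
    xs : List ℕ
    xs = sel (suc c)
    i : ℕ
    i = length xs
    A : ℕ
    A = run (sel (suc m))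

    xs++R : ∃ λ R → sel (suc m) ≡ xs ++ R
    xs++R = let (R , e) = sel-prefix (suc c) (m ∸ c) in
            R , trans (cong sel (sym (cong suc (m+[n∸m]≡n (<⇒≤ c<m))))) e

    c∈xs : c ∈ xs
    c∈xs = subst (c ∈_) (sym (sel-suc-yes c pc)) (∈-++⁺ʳ (sel c) (here refl))

    short : run xs < i → ¬ (∀ c′ → c′ ≤ c → P c′) × A ≡ run xs × run (xs ++ suc m ∷ []) ≡ run xs
    short r<i = ¬initial , A≡ , runFrom-++-short 0 xs _ r<i
      where
      A≡ : A ≡ run xs
      A≡ = let (R , e) = xs++R in trans (cong run e) (runFrom-++-short 0 xs R r<i)
      ¬initial : ¬ (∀ c′ → c′ ≤ c → P c′)
      ¬initial initial = <-irrefl (trans (cong run xs≡) (trans (runFrom-applyUpTo 0 (suc c))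
                           (sym (trans (cong length xs≡) (length-upTo (suc c)))))) r<i
        where
        xs≡ : xs ≡ upTo (suc c)
        xs≡ = all⇒sel-full (suc c) (λ c′ c′<sc → initial c′ (≤-pred c′<sc))

    full : run xs ≡ i → (∀ c′ → c′ ≤ c → P c′) × i ≤ A × run (xs ++ suc m ∷ []) ≡ i
    full r≡i = (λ c′ c′≤c → sel-full⇒all (suc c) i≡ c′ (s≤s c′≤c)) , i≤A , run-xs++
      where
      i≡ : i ≡ suc c
      i≡ = ≤-antisym (length-sel≤ (suc c)) (∈-upTo⁻ (subst (c ∈_) (runFrom-full 0 xs r≡i) c∈xs))
      i≤A : i ≤ A
      i≤A = let (R , e) = xs++R in
            subst (i ≤_) (sym (trans (cong run e) (runFrom-++-full 0 xs R r≡i))) (m≤m+n i _)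
      m+1≢i : suc m ≢ i
      m+1≢i e = <-irrefl (sym (trans e i≡)) (s≤s c<m)
      run-xs++ : run (xs ++ suc m ∷ []) ≡ i
      run-xs++ = trans (runFrom-++-full 0 xs _ r≡i)
                   (trans (cong (λ b → i + (if b then 1 else 0)) (≡ᵇ-false m+1≢i)) (+-identityʳ i))

    initial⇔ : Iff (∀ c′ → c′ ≤ c → P c′) (i ≤ A)
    initial⇔ with m≤n⇒m<n∨m≡n (runFrom≤length 0 xs)
    ... | inj₁ r<i = let (¬initial , A≡ , _) = short r<i in
                     (λ initial → ⊥-elim (¬initial initial)) , (λ i≤A → ⊥-elim (<⇒≱ r<i (subst (i ≤_) A≡ i≤A)))
    ... | inj₂ r≡i = let (initial , i≤A , _) = full r≡i in (λ _ → i≤A) , (λ _ → initial)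

    run-child : run (xs ++ suc m ∷ []) ≡ (if i ≤ᵇ A then i else A)
    run-child with m≤n⇒m<n∨m≡n (runFrom≤length 0 xs)
    ... | inj₁ r<i = let (_ , A≡ , e) = short r<i
                         i≰A = λ i≤A → <⇒≱ r<i (subst (i ≤_) A≡ i≤A) in
                     trans e (sym (trans (cong (λ b → if b then i else A) (≤ᵇ-false i≰A)) A≡))
    ... | inj₂ r≡i = let (_ , i≤A , e) = full r≡i in trans e (sym (cong (λ b → if b then i else A) (≤ᵇ-true i≤A)))

  module LastRun (m : ℕ) (pm : P m) where
    xs : List ℕ
    xs = sel (suc m)
    K : ℕ
    K = length xs
    A : ℕ
    A = run xs

    run-child : run (xs ++ suc m ∷ []) ≡ (if K ≤ᵇ A then suc K else A)
    run-child with m≤n⇒m<n∨m≡n (runFrom≤length 0 xs)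
    ... | inj₁ A<K = trans (runFrom-++-short 0 xs _ A<K) (sym (cong (λ b → if b then suc K else A) (≤ᵇ-false (<⇒≱ A<K))))
    ... | inj₂ A≡K = trans run-xs++ (sym (cong (λ b → if b then suc K else A) (≤ᵇ-true (≤-reflexive (sym A≡K)))))
      where
      m∈xs : m ∈ xs
      m∈xs = subst (m ∈_) (sym (sel-suc-yes m pm)) (∈-++⁺ʳ (sel m) (here refl))
      K≡ : K ≡ suc m
      K≡ = ≤-antisym (length-sel≤ (suc m)) (∈-upTo⁻ (subst (m ∈_) (runFrom-full 0 xs A≡K) m∈xs))
      run-xs++ : run (xs ++ suc m ∷ []) ≡ suc K
      run-xs++ = trans (runFrom-++-full 0 xs _ A≡K)
             (trans (cong (λ b → K + (if b then 1 else 0)) (trans (cong (suc m ≡ᵇ_) K≡) (≡ᵇ-refl (suc m))))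
               (+-comm K 1))

-- A permutation is summarised by (des, number of cuts, tight?, run of cuts).
-- Its children get labels that depend only on its label: inserting at the cut of rank
-- i < k (the i-th cut, counting from 1) gives innerChild, at the last cut lastChild.

record Label : Set where
  constructor label
  field
    lDes   : ℕ
    lCuts  : ℕ
    lTight : Bool
    lRun   : ℕ

labelOf : List ℕ → Label
labelOf τ = label (des τ) (length (cuts τ)) (maxdrop τ ≡ᵇ des τ) (run (cuts τ))

innerChild : Label → ℕ → Label
innerChild (label d k f a) i = label (suc d) (suc i) (f ∧ (i ≤ᵇ a)) (if i ≤ᵇ a then i else a)

lastChild : Label → Label
lastChild (label d k f a) = label d (suc k) f (if k ≤ᵇ a then suc k else a)

childLabels : Label → List Label
childLabels l = map (innerChild l) (map suc (upTo (Label.lCuts l ∸ 1))) ++ lastChild l ∷ []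

labelTree : ℕ → List Label
labelTree zero = labelOf [] ∷ []
labelTree (suc m) = concatMap childLabels (labelTree m)

cong₄ : ∀ {A B C D E : Set} (f : A → B → C → D → E) {a a′ b b′ c c′ d d′} →
  a ≡ a′ → b ≡ b′ → c ≡ c′ → d ≡ d′ → f a b c d ≡ f a′ b′ c′ d′
cong₄ f refl refl refl refl = refl

module ChildLabels (m : ℕ) (τ : List ℕ) (τ∈ : τ ∈ perms231 m) where
  open FilteredRange (isCut? τ)
  parent : Perm231 m τ
  parent = perms231-sound m τ τ∈
  bounds : PrefixBound τ × SuffixBound τ
  bounds = perms231-bounds m τ τ∈
  n : ℕ
  n = suc m
  L : Label
  L = labelOf τ

  cuts≡ : cuts τ ≡ sel (suc m)
  cuts≡ = cong (λ z → sel (suc z)) (perm-length (proj₁ parent))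

  m-cut : IsCut m τ
  m-cut = subst (λ z → IsCut z τ) (perm-length (proj₁ parent)) (cut-last τ)

  cuts-split : cuts τ ≡ sel m ++ m ∷ []
  cuts-split = trans cuts≡ (sel-suc-yes m m-cut)

  label-last : labelOf (insert m n τ) ≡ lastChild L
  label-last = cong₄ label (des-last refl)
    (trans (cong length (cuts-child parent m∈)) (trans (length-++ (sel (suc m)))
      (trans (+-comm _ 1) (cong suc (cong length (sym cuts≡))))))
    (cong₂ _≡ᵇ_ (maxdrop-last refl) (des-last refl))
    (trans (cong run (cuts-child parent m∈)) (trans (LastRun.run-child m m-cut)
      (cong₂ (λ K A → if K ≤ᵇ A then suc K else A) (cong length (sym cuts≡)) (cong run (sym cuts≡)))))
    where
    m∈ : m ∈ cuts τ
    m∈ = subst (m ∈_) (sym cuts-split) (∈-++⁺ʳ (sel m) (here refl))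
    open StatsOfChild (mkSite parent m∈)

  module Inner (c : ℕ) (c∈ : c ∈ sel m) where
    c<m : c < m
    c<m = ∈-upTo⁻ (proj₁ (∈-filter⁻ (isCut? τ) {xs = upTo m} c∈))
    c-cut : IsCut c τ
    c-cut = proj₂ (∈-filter⁻ (isCut? τ) {xs = upTo m} c∈)
    c∈cuts : c ∈ cuts τ
    c∈cuts = subst (c ∈_) (sym cuts-split) (∈-++⁺ˡ c∈)
    open StatsOfChild (mkSite parent c∈cuts)
    open StatsOfChild.Inner (mkSite parent c∈cuts) c<m (proj₁ bounds) (proj₂ bounds)
    open InnerRun c m c<m c-cut using (i; initial⇔; run-child)

    A≡ : run (sel (suc m)) ≡ run (cuts τ)
    A≡ = cong run (sym cuts≡)

    tight-child : (maxdrop σ ≡ᵇ des σ) ≡ ((maxdrop τ ≡ᵇ des τ) ∧ (i ≤ᵇ run (cuts τ)))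
    tight-child = T-ext
      (λ t → let (tight , initial) = tight⇒ (≡ᵇ⇒≡ _ _ t) in
             T∧ (≡⇒≡ᵇ _ _ tight) (≤⇒≤ᵇ (subst (i ≤_) A≡ (proj₁ initial⇔ initial))))
      (λ t → ≡⇒≡ᵇ _ _ (tight⇐ (≡ᵇ⇒≡ _ _ (T∧₁ t) , proj₂ initial⇔ (subst (i ≤_) (sym A≡) (≤ᵇ⇒≤ _ _ (T∧₂ t))))))

    label-inner : labelOf σ ≡ innerChild L i
    label-inner = cong₄ label (des-inner c<m)
      (trans (cong length (cuts-child parent c∈cuts)) (trans (length-++ (sel (suc c))) (+-comm _ 1)))
      tight-child
      (trans (cong run (cuts-child parent c∈cuts)) (trans run-child (cong (λ A → if i ≤ᵇ A then i else A) A≡)))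

  children-labels : map labelOf (children n τ) ≡ childLabels L
  children-labels = begin
      map labelOf (map (λ c → insert c n τ) (cuts τ))
        ≡⟨ sym (map-∘ (cuts τ)) ⟩
      map child (cuts τ)
        ≡⟨ cong (map child) cuts-split ⟩
      map child (sel m ++ m ∷ [])
        ≡⟨ map-++ child (sel m) (m ∷ []) ⟩
      map child (sel m) ++ child m ∷ []
        ≡⟨ cong₂ (λ a b → a ++ b ∷ []) inner-labels label-last ⟩
      map (innerChild L) (map suc (upTo (Label.lCuts L ∸ 1))) ++ lastChild L ∷ [] ∎
    where
    open ≡-Reasoning
    child : ℕ → Label
    child = λ c → labelOf (insert c n τ)
    rank : ℕ → ℕ
    rank = λ c → length (sel (suc c))
    #inner : Label.lCuts L ∸ 1 ≡ length (sel m)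
    #inner = trans (cong (λ z → length z ∸ 1) cuts-split)
               (trans (cong (_∸ 1) (length-++ (sel m))) (m+n∸n≡m (length (sel m)) 1))
    inner-labels : map child (sel m) ≡ map (innerChild L) (map suc (upTo (Label.lCuts L ∸ 1)))
    inner-labels = begin
      map child (sel m)
        ≡⟨ map-cong-local (All.tabulate (λ {c} c∈ → Inner.label-inner c c∈)) ⟩
      map (innerChild L ∘ rank) (sel m)
        ≡⟨ map-∘ (sel m) ⟩
      map (innerChild L) (map rank (sel m))
        ≡⟨ cong (map (innerChild L)) (sel-ranks m) ⟩
      map (innerChild L) (map suc (upTo (length (sel m))))
        ≡⟨ cong (λ z → map (innerChild L) (map suc (upTo z))) (sym #inner) ⟩
      map (innerChild L) (map suc (upTo (Label.lCuts L ∸ 1))) ∎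

concatMap-cong-local : ∀ {A B : Set} (f g : A → List B) xs → (∀ {x} → x ∈ xs → f x ≡ g x) →
  concatMap f xs ≡ concatMap g xs
concatMap-cong-local f g [] _ = refl
concatMap-cong-local f g (x ∷ xs) f≗g = cong₂ _++_ (f≗g (here refl)) (concatMap-cong-local f g xs (f≗g ∘ there))

labels-perms231 : ∀ m → map labelOf (perms231 m) ≡ labelTree m
labels-perms231 zero = refl
labels-perms231 (suc m) = begin
    map labelOf (concatMap (children (suc m)) (perms231 m))
      ≡⟨ map-concatMap labelOf (children (suc m)) (perms231 m) ⟩
    concatMap (map labelOf ∘ children (suc m)) (perms231 m)
      ≡⟨ concatMap-cong-local _ _ (perms231 m) (λ {τ} τ∈ → ChildLabels.children-labels m τ τ∈) ⟩
    concatMap (childLabels ∘ labelOf) (perms231 m)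
      ≡⟨ sym (concatMap-map childLabels labelOf (perms231 m)) ⟩
    concatMap childLabels (map labelOf (perms231 m))
      ≡⟨ cong (concatMap childLabels) (labels-perms231 m) ⟩
    labelTree (suc m) ∎
  where open ≡-Reasoning

-- Counting labels.  Properties of labels are Boolean tests so that counts compute;
-- count p xs is the number of entries of xs satisfying p.
ind : Bool → ℕ
ind true = 1
ind false = 0

count : {A : Set} → (A → Bool) → List A → ℕ
count p [] = 0
count p (x ∷ xs) = ind (p x) + count p xs

sumBy : {A : Set} → (A → ℕ) → List A → ℕ
sumBy w [] = 0
sumBy w (x ∷ xs) = w x + sumBy w xs

count-++ : ∀ {A : Set} (p : A → Bool) xs ys → count p (xs ++ ys) ≡ count p xs + count p ys
count-++ p [] ys = refl
count-++ p (x ∷ xs) ys = trans (cong (ind (p x) +_) (count-++ p xs ys)) (sym (+-assoc (ind (p x)) _ _))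

count-map : ∀ {A B : Set} (p : B → Bool) (f : A → B) xs → count p (map f xs) ≡ count (p ∘ f) xs
count-map p f [] = refl
count-map p f (x ∷ xs) = cong (ind (p (f x)) +_) (count-map p f xs)

count-concatMap : ∀ {A B : Set} (p : B → Bool) (f : A → List B) xs → count p (concatMap f xs) ≡ sumBy (count p ∘ f) xs
count-concatMap p f [] = refl
count-concatMap p f (x ∷ xs) = trans (count-++ p (f x) (concatMap f xs)) (cong (count p (f x) +_) (count-concatMap p f xs))

sumBy-cong-local : ∀ {A : Set} (w w' : A → ℕ) xs → (∀ {x} → x ∈ xs → w x ≡ w' x) → sumBy w xs ≡ sumBy w' xs
sumBy-cong-local w w' [] h = refl
sumBy-cong-local w w' (x ∷ xs) h = cong₂ _+_ (h (here refl)) (sumBy-cong-local w w' xs (h ∘ there))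

sumBy-+ : ∀ {A : Set} (w1 w2 : A → ℕ) xs → sumBy (λ x → w1 x + w2 x) xs ≡ sumBy w1 xs + sumBy w2 xs
sumBy-+ w1 w2 [] = refl
sumBy-+ w1 w2 (x ∷ xs) rewrite sumBy-+ w1 w2 xs = interchange (w1 x) (w2 x) (sumBy w1 xs) (sumBy w2 xs)
  where
  interchange : ∀ a b c d → a + b + (c + d) ≡ a + c + (b + d)
  interchange = solve-∀

sumBy-ind : ∀ {A : Set} (p : A → Bool) xs → sumBy (λ x → ind (p x)) xs ≡ count p xs
sumBy-ind p [] = refl
sumBy-ind p (x ∷ xs) = cong (ind (p x) +_) (sumBy-ind p xs)

count-none : ∀ {A : Set} (p : A → Bool) xs → (∀ {x} → x ∈ xs → p x ≡ false) → count p xs ≡ 0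
count-none p [] h = refl
count-none p (x ∷ xs) h rewrite h (here refl) = count-none p xs (h ∘ there)

count-cong-local : ∀ {A : Set} (p q : A → Bool) xs → (∀ {x} → x ∈ xs → p x ≡ q x) → count p xs ≡ count q xs
count-cong-local p q [] h = refl
count-cong-local p q (x ∷ xs) h = cong₂ _+_ (cong ind (h (here refl))) (count-cong-local p q xs (h ∘ there))

count-const∧ : ∀ {A : Set} (c : Bool) (p : A → Bool) xs → count (λ x → c ∧ p x) xs ≡ (if c then count p xs else 0)
count-const∧ true p xs = refl
count-const∧ false p xs = count-none _ xs (λ _ → refl)

count-∨-disjoint : ∀ {A : Set} (p q : A → Bool) xs → (∀ {x} → x ∈ xs → (p x ∧ q x) ≡ false) →
  count (λ x → p x ∨ q x) xs ≡ count p xs + count q xs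
count-∨-disjoint p q [] h = refl
count-∨-disjoint p q (x ∷ xs) h with p x in ep | q x in eq | h (here refl)
... | true | true | ()
... | true | false | _ = cong suc (count-∨-disjoint p q xs (h ∘ there))
... | false | true | _ = trans (cong suc (count-∨-disjoint p q xs (h ∘ there))) (sym (+-suc (count p xs) (count q xs)))
... | false | false | _ = count-∨-disjoint p q xs (h ∘ there)

-- Labels occurring at level m: the identity permutation (no descent, all m+1 positions
-- are cuts), or 1 ≤ des, and the run of cuts is at least 1 but shorter than the cuts, of
-- which there are at most m.
Shape : ℕ → Label → Set
Shape m (label d k f a) = (d ≡ 0 × k ≡ suc m × f ≡ true × a ≡ suc m) ⊎ (1 ≤ d × 1 ≤ a × a < k × k ≤ m)

∈-inner-ranks : ∀ {i k} → i ∈ map suc (upTo (k ∸ 1)) → 1 ≤ i × i < k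
∈-inner-ranks {i} {k} p with ∈-map⁻ suc p
... | j , jin , refl = s≤s z≤n , lt (∈-upTo⁻ jin)
  where
  lt : ∀ {j k} → j < k ∸ 1 → suc j < k
  lt {j} {suc k} l = s≤s l

lastChild-shape : ∀ {m d k f a} → Shape m (label d k f a) → Shape (suc m) (lastChild (label d k f a))
lastChild-shape {m} (inj₁ (refl , refl , refl , refl)) rewrite ≤ᵇ-true (≤-refl {suc m}) = inj₁ (refl , refl , refl , refl)
lastChild-shape (inj₂ (d≥1 , a≥1 , a<k , k≤m)) rewrite ≤ᵇ-false (<⇒≱ a<k) =
  inj₂ (d≥1 , a≥1 , ≤-trans a<k (n≤1+n _) , s≤s k≤m)

innerChild-shape : ∀ {m d k f a i} → Shape m (label d k f a) → 1 ≤ i × i < k →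
  Shape (suc m) (innerChild (label d k f a) i)
innerChild-shape (inj₁ (refl , refl , refl , refl)) (i≥1 , i<k) rewrite ≤ᵇ-true (<⇒≤ i<k) =
  inj₂ (s≤s z≤n , i≥1 , ≤-refl , i<k)
innerChild-shape {m} {a = a} {i} (inj₂ (_ , a≥1 , a<k , k≤m)) (i≥1 , i<k) with i ≤? a
... | yes i≤a rewrite ≤ᵇ-true i≤a = inj₂ (s≤s z≤n , i≥1 , ≤-refl , ≤-trans i<k (≤-trans k≤m (n≤1+n m)))
... | no i≰a rewrite ≤ᵇ-false i≰a =
  inj₂ (s≤s z≤n , a≥1 , ≤-trans (≰⇒> i≰a) (n≤1+n i) , ≤-trans i<k (≤-trans k≤m (n≤1+n m)))

labelTree-shape : ∀ m l → l ∈ labelTree m → Shape m l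
labelTree-shape zero _ (here refl) = inj₁ (refl , refl , refl , refl)
labelTree-shape (suc m) l l∈ with find (∈-concatMap⁻ childLabels {xs = labelTree m} l∈)
... | label d k f a , l₀∈ , l∈children with ∈-++⁻ (map (innerChild (label d k f a)) (map suc (upTo (k ∸ 1)))) l∈children
...   | inj₂ (here refl) = lastChild-shape (labelTree-shape m _ l₀∈)
...   | inj₁ l∈inner with ∈-map⁻ (innerChild (label d k f a)) l∈inner
...     | i , i∈ , refl = innerChild-shape (labelTree-shape m _ l₀∈) (∈-inner-ranks {k = k} i∈)

count-upTo-suc : ∀ (p : ℕ → Bool) M → count p (upTo (suc M)) ≡ count p (upTo M) + ind (p M)
count-upTo-suc p M =
  trans (cong (count p) (sym (upTo-∷ʳ M)))
    (trans (count-++ p (upTo M) (M ∷ [])) (cong (count p (upTo M) +_) (+-identityʳ _)))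

count-≡ᵇ-upTo : ∀ j₀ M → count (_≡ᵇ j₀) (upTo M) ≡ ind (j₀ <ᵇ M)
count-≡ᵇ-upTo j₀ zero = refl
count-≡ᵇ-upTo j₀ (suc M) =
  trans (count-upTo-suc (_≡ᵇ j₀) M) (trans (cong (_+ ind (M ≡ᵇ j₀)) (count-≡ᵇ-upTo j₀ M)) (step (<-cmp j₀ M)))
  where
  step : Tri (j₀ < M) (j₀ ≡ M) (M < j₀) → ind (j₀ <ᵇ M) + ind (M ≡ᵇ j₀) ≡ ind (j₀ <ᵇ suc M)
  step (tri< j₀<M _ _)
    rewrite <ᵇ-true j₀<M | ≡ᵇ-false {M} {j₀} (λ e → <-irrefl (sym e) j₀<M) | <ᵇ-true (≤-trans j₀<M (n≤1+n M)) = refl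
  step (tri≈ _ refl _) rewrite <ᵇ-false (<-irrefl {j₀} refl) | ≡ᵇ-refl j₀ | <ᵇ-true (n<1+n j₀) = refl
  step (tri> _ _ M<j₀)
    rewrite <ᵇ-false (<⇒≯ M<j₀) | ≡ᵇ-false {M} {j₀} (λ e → <-irrefl e M<j₀) | <ᵇ-false {j₀} {suc M} (λ l → <⇒≱ M<j₀ (≤-pred l))
    = refl

count-distance-upTo : ∀ m u M → M ≤ suc m →
  count (λ j → (m ∸ j) ≡ᵇ u) (upTo M) ≡ ind ((u ≤ᵇ m) ∧ ((m ∸ u) <ᵇ M))
count-distance-upTo m u M M≤ with u ≤? m
... | yes u≤m rewrite ≤ᵇ-true u≤m =
  trans (count-cong-local _ _ (upTo M) (λ {j} j∈ → distance≡ j (≤-trans (∈-upTo⁻ j∈) M≤))) (count-≡ᵇ-upTo (m ∸ u) M)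
  where
  distance≡ : ∀ j → suc j ≤ suc m → ((m ∸ j) ≡ᵇ u) ≡ (j ≡ᵇ (m ∸ u))
  distance≡ j (s≤s j≤m) = T-ext
    (λ t → ≡⇒≡ᵇ j (m ∸ u) (trans (sym (m∸[m∸n]≡n j≤m)) (cong (m ∸_) (≡ᵇ⇒≡ (m ∸ j) u t))))
    (λ t → ≡⇒≡ᵇ (m ∸ j) u (trans (cong (m ∸_) (≡ᵇ⇒≡ j (m ∸ u) t)) (m∸[m∸n]≡n u≤m)))
... | no u≰m rewrite ≤ᵇ-false u≰m =
  count-none _ (upTo M) (λ {j} _ → ≡ᵇ-false (λ e → u≰m (subst (_≤ m) e (m∸n≤m m j))))

count-prefix : ∀ A t (q : ℕ → Bool) → count (λ j → (j <ᵇ A) ∧ q j) (upTo (A + t)) ≡ count q (upTo A)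
count-prefix A zero q =
  trans (cong (λ z → count (λ j → (j <ᵇ A) ∧ q j) (upTo z)) (+-identityʳ A))
    (count-cong-local _ _ (upTo A) (λ {j} j∈ → cong (_∧ q j) (<ᵇ-true (∈-upTo⁻ j∈))))
count-prefix A (suc t) q =
  trans (cong (λ z → count (λ j → (j <ᵇ A) ∧ q j) (upTo z)) (+-suc A t))
    (trans (count-upTo-suc _ (A + t))
      (trans (cong (λ b → count (λ j → (j <ᵇ A) ∧ q j) (upTo (A + t)) + ind (b ∧ q (A + t)))
                   (<ᵇ-false (λ l → <⇒≱ l (m≤m+n A t))))
        (trans (+-identityʳ _) (count-prefix A t q))))

uncut : ℕ → Label → ℕ
uncut m l = suc m ∸ Label.lCuts l

runGap : ℕ → Label → ℕ
runGap m l = suc m ∸ Label.lRun l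

hasDesUncut : ℕ → ℕ → ℕ → Label → Bool
hasDesUncut D u m l = (Label.lDes l ≡ᵇ D) ∧ (uncut m l ≡ᵇ u)

hasDesUncut< : ℕ → ℕ → ℕ → Label → Bool
hasDesUncut< D u m l = (Label.lDes l ≡ᵇ D) ∧ (uncut m l <ᵇ u)

isTightGap : ℕ → ℕ → ℕ → Label → Bool
isTightGap D b m l = Label.lTight l ∧ ((Label.lDes l ≡ᵇ D) ∧ (runGap m l ≡ᵇ b))

isTightGap< : ℕ → ℕ → ℕ → Label → Bool
isTightGap< D b m l = Label.lTight l ∧ ((Label.lDes l ≡ᵇ D) ∧ (runGap m l <ᵇ b))

∸<⇔<+ : ∀ {m u k} → u ≤ m → Iff (m ∸ u < k) (m < u + k)
∸<⇔<+ {m} {u} {k} ul = (λ lt → subst₂ _<_ (m∸n+n≡m ul) (+-comm k u) (+-monoˡ-< u lt)) ,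
                     (λ lt → +-cancelʳ-< u (m ∸ u) k (subst₂ _<_ (sym (m∸n+n≡m ul)) (+-comm u k) lt))

<ᵇ-cong : ∀ {a b c d} → Iff (a < b) (c < d) → (a <ᵇ b) ≡ (c <ᵇ d)
<ᵇ-cong {a} {b} {c} {d} (f , g) = T-ext (λ t → <⇒<ᵇ (f (<ᵇ⇒< a b t))) (λ t → <⇒<ᵇ (g (<ᵇ⇒< c d t)))

∸<ᵇ-swap : ∀ {m u k'} → u ≤ m → k' ≤ m → ((m ∸ u) <ᵇ k') ≡ ((m ∸ k') <ᵇ u)
∸<ᵇ-swap {m} {u} {k'} ul kl = <ᵇ-cong ((λ lt → proj₂ (∸<⇔<+ kl) (subst (m <_) (+-comm u k') (proj₁ (∸<⇔<+ ul) lt))) ,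
                                 (λ lt → proj₂ (∸<⇔<+ ul) (subst (m <_) (+-comm k' u) (proj₁ (∸<⇔<+ kl) lt))))

shape-cuts : ∀ {m d k f a} → Shape m (label d k f a) → 1 ≤ k × k ≤ suc m
shape-cuts (inj₁ (_ , refl , _ , _)) = s≤s z≤n , ≤-refl
shape-cuts {m} (inj₂ (_ , a≥1 , a<k , k≤m)) = ≤-trans a≥1 (<⇒≤ a<k) , ≤-trans k≤m (n≤1+n m)

count-childLabels : ∀ (p : Label → Bool) d k f a → let l = label d k f a in
  count p (childLabels l) ≡ ind (p (lastChild l)) + count (λ j → p (innerChild l (suc j))) (upTo (k ∸ 1))
count-childLabels p d k f a = begin
    count p (map (innerChild l) (map suc (upTo (k ∸ 1))) ++ lastChild l ∷ [])
      ≡⟨ count-++ p (map (innerChild l) (map suc (upTo (k ∸ 1)))) (lastChild l ∷ []) ⟩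
    count p (map (innerChild l) (map suc (upTo (k ∸ 1)))) + (ind (p (lastChild l)) + 0)
      ≡⟨ cong₂ _+_ (trans (count-map p (innerChild l) (map suc (upTo (k ∸ 1))))
                           (count-map (p ∘ innerChild l) suc (upTo (k ∸ 1))))
                    (+-identityʳ _) ⟩
    count (λ j → p (innerChild l (suc j))) (upTo (k ∸ 1)) + ind (p (lastChild l))
      ≡⟨ +-comm _ (ind (p (lastChild l))) ⟩
    ind (p (lastChild l)) + count (λ j → p (innerChild l (suc j))) (upTo (k ∸ 1)) ∎
  where
  open ≡-Reasoning
  l : Label
  l = label d k f a

-- An inner child of rank j+1 has m+1−j non-cuts and one more descent; the last child
-- keeps both statistics.  So the parent contributes to "D+1 descents, u non-cuts" once
-- through its last child, and once more if it has D descents and fewer than u non-cuts.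
count-desUncut-children : ∀ m l → Shape m l → ∀ e u →
  count (hasDesUncut (suc e) u (suc m)) (childLabels l)
  ≡ ind (hasDesUncut (suc e) u m l) + ind ((u ≤ᵇ m) ∧ hasDesUncut< e u m l)
count-desUncut-children m (label d k f a) shape e u =
  trans (count-childLabels (hasDesUncut (suc e) u (suc m)) d k f a)
    (cong (ind (hasDesUncut (suc e) u m (label d k f a)) +_)
      (trans (count-const∧ (d ≡ᵇ e) (λ j → (m ∸ j) ≡ᵇ u) (upTo (k ∸ 1)))
        (trans (cong (λ z → if d ≡ᵇ e then z else 0) (count-distance-upTo m u (k ∸ 1) k∸1≤))
          inner-count)))
  where
  k∸1≤ : k ∸ 1 ≤ suc m
  k∸1≤ = ≤-trans (m∸n≤m k 1) (proj₂ (shape-cuts shape))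
  inner-count : (if d ≡ᵇ e then ind ((u ≤ᵇ m) ∧ ((m ∸ u) <ᵇ (k ∸ 1))) else 0)
                ≡ ind ((u ≤ᵇ m) ∧ ((d ≡ᵇ e) ∧ ((suc m ∸ k) <ᵇ u)))
  inner-count with d ≡ᵇ e
  ... | false = sym (cong ind (∧-zeroʳ (u ≤ᵇ m)))
  ... | true with u ≤? m | shape-cuts shape
  ...   | no u≰m | _ rewrite ≤ᵇ-false u≰m = refl
  ...   | yes u≤m | (s≤s {n = k′} z≤n , s≤s k′≤m) rewrite ≤ᵇ-true u≤m = cong ind (∸<ᵇ-swap u≤m k′≤m)

isTightGap-innerChild : ∀ m d k f a E b j →
  isTightGap (suc E) (suc b) (suc m) (innerChild (label d k f a) (suc j))
  ≡ (f ∧ (d ≡ᵇ E)) ∧ ((j <ᵇ a) ∧ ((suc m ∸ j) ≡ᵇ suc b))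
isTightGap-innerChild m d k f a E b j with j <ᵇ a | f
... | true | true = refl
... | true | false = refl
... | false | true = sym (∧-zeroʳ (d ≡ᵇ E))
... | false | false = refl

count-tightGap-inner : ∀ m d k f a E b →
  count (λ j → isTightGap (suc E) (suc b) (suc m) (innerChild (label d k f a) (suc j))) (upTo (k ∸ 1))
  ≡ (if f ∧ (d ≡ᵇ E) then count (λ j → (j <ᵇ a) ∧ ((suc m ∸ j) ≡ᵇ suc b)) (upTo (k ∸ 1)) else 0)
count-tightGap-inner m d k f a E b =
  trans (count-cong-local _ (λ j → (f ∧ (d ≡ᵇ E)) ∧ ((j <ᵇ a) ∧ ((suc m ∸ j) ≡ᵇ suc b))) (upTo (k ∸ 1))
           (λ {j} _ → isTightGap-innerChild m d k f a E b j))
        (count-const∧ (f ∧ (d ≡ᵇ E)) _ (upTo (k ∸ 1)))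

<ᵇ-suc : ∀ b m → (b <ᵇ suc m) ≡ (b ≤ᵇ m)
<ᵇ-suc zero m = refl
<ᵇ-suc (suc b) m = refl

count-gap-identity : ∀ m b → count (λ j → (j <ᵇ suc m) ∧ ((suc m ∸ j) ≡ᵇ suc b)) (upTo (suc m ∸ 1))
  ≡ ind ((b ≤ᵇ m) ∧ ((m ∸ b) <ᵇ m))
count-gap-identity m b =
  trans (count-cong-local _ (λ j → (suc m ∸ j) ≡ᵇ suc b) (upTo m)
           (λ {j} j∈ → cong (_∧ ((suc m ∸ j) ≡ᵇ suc b)) (<ᵇ-true (≤-trans (∈-upTo⁻ j∈) (n≤1+n m)))))
    (trans (count-distance-upTo (suc m) (suc b) m (≤-trans (n≤1+n m) (n≤1+n (suc m))))
           (cong (λ z → ind (z ∧ ((m ∸ b) <ᵇ m))) (<ᵇ-suc b m)))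

count-gap-below-run : ∀ m k a b → a < k → k ≤ suc m →
  count (λ j → (j <ᵇ a) ∧ ((suc m ∸ j) ≡ᵇ suc b)) (upTo (k ∸ 1)) ≡ ind ((b ≤ᵇ m) ∧ ((m ∸ b) <ᵇ a))
count-gap-below-run m (suc k) a b (s≤s a≤k) k≤ =
  trans (cong (λ z → count (λ j → (j <ᵇ a) ∧ ((suc m ∸ j) ≡ᵇ suc b)) (upTo z)) (sym (m+[n∸m]≡n a≤k)))
    (trans (count-prefix a (k ∸ a) _)
      (trans (count-distance-upTo (suc m) (suc b) a (≤-trans a≤k (≤-trans (≤-pred k≤) (≤-trans (n≤1+n m) (n≤1+n (suc m))))))
             (cong (λ z → ind (z ∧ ((m ∸ b) <ᵇ a))) (<ᵇ-suc b m))))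

isTightGap-lastChild : ∀ m d k f a E b → Shape m (label d k f a) →
  ind (isTightGap (suc E) (suc b) (suc m) (lastChild (label d k f a))) ≡ ind (isTightGap (suc E) b m (label d k f a))
isTightGap-lastChild m d k f a E b (inj₁ (refl , refl , refl , refl)) = refl
isTightGap-lastChild m d k f a E b (inj₂ (_ , _ , a<k , k≤m))
  rewrite ≤ᵇ-false (<⇒≱ a<k) | +-∸-assoc 1 (≤-trans (<⇒≤ a<k) (≤-trans k≤m (n≤1+n m))) = refl

-- For D+2 descents: the inner children contribute iff the parent is tight with D+1
-- descents and its run gap is at most b+1; the identity permutation contributes nothing.
inner-tightGap₂ : ∀ m d k f a e b → Shape m (label d k f a) →
  (if f ∧ (d ≡ᵇ suc e) then count (λ j → (j <ᵇ a) ∧ ((suc m ∸ j) ≡ᵇ suc b)) (upTo (k ∸ 1)) else 0)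
  ≡ ind ((b ≤ᵇ m) ∧ (f ∧ ((d ≡ᵇ suc e) ∧ ((suc m ∸ a) <ᵇ suc b))))
inner-tightGap₂ m d k f a e b (inj₁ (refl , refl , refl , refl)) = sym (cong ind (∧-zeroʳ (b ≤ᵇ m)))
inner-tightGap₂ m d k false a e b (inj₂ _) = sym (cong ind (∧-zeroʳ (b ≤ᵇ m)))
inner-tightGap₂ m d k true a e b (inj₂ (_ , a≥1 , a<k , k≤m)) with d ≡ᵇ suc e
... | false = sym (cong ind (∧-zeroʳ (b ≤ᵇ m)))
... | true = trans (count-gap-below-run m k a b a<k (≤-trans k≤m (n≤1+n m)))
                   (cong ind (gap-swap a≥1 (≤-pred (≤-trans a<k (≤-trans k≤m (n≤1+n m))))))
  where
  gap-swap : 1 ≤ a → a ≤ m → ((b ≤ᵇ m) ∧ ((m ∸ b) <ᵇ a)) ≡ ((b ≤ᵇ m) ∧ ((suc m ∸ a) <ᵇ suc b))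
  gap-swap (s≤s {n = a′} z≤n) a≤m with b ≤? m
  ... | no b≰m rewrite ≤ᵇ-false b≰m = refl
  ... | yes b≤m rewrite ≤ᵇ-true b≤m = ∸<ᵇ-swap′
    where
    a′≤m : a′ ≤ m
    a′≤m = ≤-trans (n≤1+n a′) a≤m
    swap : ∀ x y → y + suc x ≡ x + suc y
    swap x y = trans (+-suc y x) (trans (cong suc (+-comm y x)) (sym (+-suc x y)))
    ∸<ᵇ-swap′ : ((m ∸ b) <ᵇ suc a′) ≡ ((m ∸ a′) <ᵇ suc b)
    ∸<ᵇ-swap′ = <ᵇ-cong
      ((λ lt → proj₂ (∸<⇔<+ a′≤m) (subst (m <_) (swap a′ b) (proj₁ (∸<⇔<+ b≤m) lt))) ,
       (λ lt → proj₂ (∸<⇔<+ b≤m) (subst (m <_) (sym (swap a′ b)) (proj₁ (∸<⇔<+ a′≤m) lt))))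

count-tightGap-children₂ : ∀ m l → Shape m l → ∀ e b →
  count (isTightGap (suc (suc e)) (suc b) (suc m)) (childLabels l)
  ≡ ind (isTightGap (suc (suc e)) b m l) + ind ((b ≤ᵇ m) ∧ isTightGap< (suc e) (suc b) m l)
count-tightGap-children₂ m (label d k f a) shape e b =
  trans (count-childLabels _ d k f a)
    (cong₂ _+_ (isTightGap-lastChild m d k f a (suc e) b shape)
               (trans (count-tightGap-inner m d k f a (suc e) b) (inner-tightGap₂ m d k f a e b shape)))

-- For one descent: only the identity permutation has inner children without descents,
-- one for each gap 1 ≤ b ≤ m.
inner-tightGap₁ : ∀ m d k f a b → Shape m (label d k f a) →
  (if f ∧ (d ≡ᵇ 0) then count (λ j → (j <ᵇ a) ∧ ((suc m ∸ j) ≡ᵇ suc b)) (upTo (k ∸ 1)) else 0)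
  ≡ ind ((d ≡ᵇ 0) ∧ ((1 ≤ᵇ b) ∧ (b ≤ᵇ m)))
inner-tightGap₁ m d k f a b (inj₁ (refl , refl , refl , refl)) = trans (count-gap-identity m b) (cong ind (in-range b))
  where
  in-range : ∀ b → ((b ≤ᵇ m) ∧ ((m ∸ b) <ᵇ m)) ≡ ((1 ≤ᵇ b) ∧ (b ≤ᵇ m))
  in-range zero rewrite <ᵇ-false (<-irrefl {m} refl) = ∧-zeroʳ true
  in-range (suc b) with suc b ≤? m
  ... | no b≰m rewrite ≤ᵇ-false b≰m = refl
  ... | yes b≤m rewrite ≤ᵇ-true b≤m = <ᵇ-true (∸-monoʳ-< {m} {suc b} {0} (s≤s z≤n) b≤m)
inner-tightGap₁ m (suc d) k true a b (inj₂ _) = refl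
inner-tightGap₁ m (suc d) k false a b (inj₂ _) = refl

count-tightGap-children₁ : ∀ m l → Shape m l → ∀ b →
  count (isTightGap 1 (suc b) (suc m)) (childLabels l)
  ≡ ind (isTightGap 1 b m l) + ind ((Label.lDes l ≡ᵇ 0) ∧ ((1 ≤ᵇ b) ∧ (b ≤ᵇ m)))
count-tightGap-children₁ m (label d k f a) shape b =
  trans (count-childLabels _ d k f a)
    (cong₂ _+_ (isTightGap-lastChild m d k f a 0 b shape)
               (trans (count-tightGap-inner m d k f a 0 b) (inner-tightGap₁ m d k f a b shape)))

count-nextLevel : ∀ m (p A B : Label → Bool) →
  (∀ {l} → l ∈ labelTree m → count p (childLabels l) ≡ ind (A l) + ind (B l)) →
  count p (labelTree (suc m)) ≡ count A (labelTree m) + count B (labelTree m)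
count-nextLevel m p A B per-label =
  trans (count-concatMap p childLabels (labelTree m))
    (trans (sumBy-cong-local _ (λ l → ind (A l) + ind (B l)) (labelTree m) per-label)
      (trans (sumBy-+ (λ l → ind (A l)) (λ l → ind (B l)) (labelTree m))
        (cong₂ _+_ (sumBy-ind A (labelTree m)) (sumBy-ind B (labelTree m)))))

-- the identity permutation is the only one without descents
isIdentity : Label → Bool
isIdentity l = Label.lDes l ≡ᵇ 0

count-identity-children : ∀ l → count isIdentity (childLabels l) ≡ ind (isIdentity l) + ind false
count-identity-children (label d k f a) =
  trans (count-childLabels isIdentity d k f a) (cong (ind (d ≡ᵇ 0) +_) (count-none _ (upTo (k ∸ 1)) (λ _ → refl)))

unique-identity : ∀ m → count isIdentity (labelTree m) ≡ 1
unique-identity zero = refl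
unique-identity (suc m) =
  trans (count-nextLevel m isIdentity isIdentity (λ _ → false) (λ {l} _ → count-identity-children l))
    (cong₂ _+_ (unique-identity m) (count-none _ (labelTree m) (λ _ → refl)))

#desUncut #desUncut< #tightGap #tightGap< : ℕ → ℕ → ℕ → ℕ
#desUncut m D u = count (hasDesUncut D u m) (labelTree m)
#desUncut< m D u = count (hasDesUncut< D u m) (labelTree m)
#tightGap m D b = count (isTightGap D b m) (labelTree m)
#tightGap< m D b = count (isTightGap< D b m) (labelTree m)

-- labels with e+1 descents and u non-cuts: last children of such labels, and one inner
-- child of each label with e descents and fewer than u non-cuts
#desUncut-rec : ∀ m e u →
  #desUncut (suc m) (suc e) u ≡ #desUncut m (suc e) u + (if u ≤ᵇ m then #desUncut< m e u else 0)
#desUncut-rec m e u =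
  trans (count-nextLevel m _ (hasDesUncut (suc e) u m) (λ l → (u ≤ᵇ m) ∧ hasDesUncut< e u m l)
           (λ {l} l∈ → count-desUncut-children m l (labelTree-shape m l l∈) e u))
    (cong (#desUncut m (suc e) u +_) (count-const∧ (u ≤ᵇ m) (hasDesUncut< e u m) (labelTree m)))

-- tight labels with e+2 descents and gap b+1: last children of those with gap b, and one
-- inner child of each tight label with e+1 descents and gap at most b
#tightGap-rec₂ : ∀ m e b →
  #tightGap (suc m) (suc (suc e)) (suc b) ≡ #tightGap m (suc (suc e)) b + (if b ≤ᵇ m then #tightGap< m (suc e) (suc b) else 0)
#tightGap-rec₂ m e b =
  trans (count-nextLevel m _ (isTightGap (suc (suc e)) b m) (λ l → (b ≤ᵇ m) ∧ isTightGap< (suc e) (suc b) m l)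
           (λ {l} l∈ → count-tightGap-children₂ m l (labelTree-shape m l l∈) e b))
    (cong (#tightGap m (suc (suc e)) b +_) (count-const∧ (b ≤ᵇ m) (isTightGap< (suc e) (suc b) m) (labelTree m)))

-- tight labels with one descent and gap b+1: last children of those with gap b, and the
-- inner child of the identity with that gap when 1 ≤ b ≤ m
#tightGap-rec₁ : ∀ m b → #tightGap (suc m) 1 (suc b) ≡ #tightGap m 1 b + ind ((1 ≤ᵇ b) ∧ (b ≤ᵇ m))
#tightGap-rec₁ m b =
  trans (count-nextLevel m _ (isTightGap 1 b m) (λ l → isIdentity l ∧ in-range)
           (λ {l} l∈ → count-tightGap-children₁ m l (labelTree-shape m l l∈) b))
    (cong (#tightGap m 1 b +_)
      (trans (count-cong-local _ (λ l → in-range ∧ isIdentity l) (labelTree m) (λ {l} _ → ∧-comm (isIdentity l) in-range))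
        (trans (count-const∧ in-range isIdentity (labelTree m)) (only-identity in-range))))
  where
  in-range : Bool
  in-range = (1 ≤ᵇ b) ∧ (b ≤ᵇ m)
  only-identity : ∀ c → (if c then count isIdentity (labelTree m) else 0) ≡ ind c
  only-identity true = unique-identity m
  only-identity false = refl

<ᵇ-suc-∨ : ∀ x u → (x <ᵇ suc u) ≡ ((x <ᵇ u) ∨ (x ≡ᵇ u))
<ᵇ-suc-∨ zero zero = refl
<ᵇ-suc-∨ zero (suc u) = refl
<ᵇ-suc-∨ (suc x) zero = refl
<ᵇ-suc-∨ (suc x) (suc u) = <ᵇ-suc-∨ x u

<ᵇ-≡ᵇ-disjoint : ∀ x u → ((x <ᵇ u) ∧ (x ≡ᵇ u)) ≡ false
<ᵇ-≡ᵇ-disjoint zero zero = refl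
<ᵇ-≡ᵇ-disjoint zero (suc u) = refl
<ᵇ-≡ᵇ-disjoint (suc x) zero = refl
<ᵇ-≡ᵇ-disjoint (suc x) (suc u) = <ᵇ-≡ᵇ-disjoint x u

∧-disjoint : ∀ d X Y → (X ∧ Y) ≡ false → ((d ∧ X) ∧ (d ∧ Y)) ≡ false
∧-disjoint true X Y e = e
∧-disjoint false X Y e = refl

#desUncut<-suc : ∀ m D u → #desUncut< m D (suc u) ≡ #desUncut< m D u + #desUncut m D u
#desUncut<-suc m D u =
  trans (count-cong-local _ (λ l → hasDesUncut< D u m l ∨ hasDesUncut D u m l) (labelTree m)
           (λ {l} _ → trans (cong (hasDes l ∧_) (<ᵇ-suc-∨ (uncut m l) u))
                            (∧-distribˡ-∨ (hasDes l) (uncut m l <ᵇ u) (uncut m l ≡ᵇ u))))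
    (count-∨-disjoint _ _ (labelTree m)
      (λ {l} _ → ∧-disjoint (hasDes l) (uncut m l <ᵇ u) (uncut m l ≡ᵇ u) (<ᵇ-≡ᵇ-disjoint (uncut m l) u)))
  where
  hasDes : Label → Bool
  hasDes l = Label.lDes l ≡ᵇ D

#tightGap<-suc : ∀ m D b → #tightGap< m D (suc b) ≡ #tightGap< m D b + #tightGap m D b
#tightGap<-suc m D b =
  trans (count-cong-local _ (λ l → isTightGap< D b m l ∨ isTightGap D b m l) (labelTree m)
           (λ {l} _ → trans (cong (λ z → Label.lTight l ∧ (hasDes l ∧ z)) (<ᵇ-suc-∨ (runGap m l) b))
             (trans (cong (Label.lTight l ∧_) (∧-distribˡ-∨ (hasDes l) (runGap m l <ᵇ b) (runGap m l ≡ᵇ b)))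
               (∧-distribˡ-∨ (Label.lTight l) (hasDes l ∧ (runGap m l <ᵇ b)) (hasDes l ∧ (runGap m l ≡ᵇ b))))))
    (count-∨-disjoint _ _ (labelTree m)
      (λ {l} _ → ∧-disjoint (Label.lTight l) (hasDes l ∧ (runGap m l <ᵇ b)) (hasDes l ∧ (runGap m l ≡ᵇ b))
        (∧-disjoint (hasDes l) (runGap m l <ᵇ b) (runGap m l ≡ᵇ b) (<ᵇ-≡ᵇ-disjoint (runGap m l) b))))
  where
  hasDes : Label → Bool
  hasDes l = Label.lDes l ≡ᵇ D

desUncut<-des0 : ∀ m l → Shape m l → ∀ u → hasDesUncut< 0 (suc u) m l ≡ isIdentity l
desUncut<-des0 m (label d k f a) (inj₁ (refl , refl , refl , refl)) u rewrite n∸n≡0 m = refl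
desUncut<-des0 m (label (suc d) k f a) (inj₂ _) u = refl

#desUncut<-des0 : ∀ m u → #desUncut< m 0 (suc u) ≡ 1
#desUncut<-des0 m u =
  trans (count-cong-local _ isIdentity (labelTree m) (λ {l} l∈ → desUncut<-des0 m l (labelTree-shape m l l∈) u))
    (unique-identity m)

desUncut-uncut0 : ∀ m l → Shape m l → ∀ e → hasDesUncut (suc e) 0 m l ≡ false
desUncut-uncut0 m (label d k f a) (inj₁ (refl , refl , refl , refl)) e = refl
desUncut-uncut0 m (label d k f a) (inj₂ (_ , _ , _ , k≤m)) e rewrite +-∸-assoc 1 k≤m = ∧-zeroʳ _

#desUncut-uncut0 : ∀ m e → #desUncut m (suc e) 0 ≡ 0
#desUncut-uncut0 m e = count-none _ (labelTree m) (λ {l} l∈ → desUncut-uncut0 m l (labelTree-shape m l l∈) e)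

desUncut-uncut-top : ∀ m l → Shape m l → ∀ D → hasDesUncut D (suc m) m l ≡ false
desUncut-uncut-top m (label d k f a) (inj₁ (refl , refl , refl , refl)) D rewrite n∸n≡0 m = ∧-zeroʳ _
desUncut-uncut-top m (label d (suc k) f a) (inj₂ (_ , s≤s z≤n , _ , _)) D =
  trans (cong ((d ≡ᵇ D) ∧_) (≡ᵇ-false (λ e → 1+n≰n (subst (_≤ m) e (m∸n≤m m k))))) (∧-zeroʳ _)

#desUncut-uncut-top : ∀ m D → #desUncut m D (suc m) ≡ 0
#desUncut-uncut-top m D = count-none _ (labelTree m) (λ {l} l∈ → desUncut-uncut-top m l (labelTree-shape m l l∈) D)

tightGap-gap0 : ∀ m l → Shape m l → ∀ e → isTightGap (suc e) 0 m l ≡ false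
tightGap-gap0 m (label d k f a) (inj₁ (refl , refl , refl , refl)) e = refl
tightGap-gap0 m (label d k f a) (inj₂ (_ , _ , a<k , k≤m)) e rewrite +-∸-assoc 1 (≤-trans (<⇒≤ a<k) k≤m) =
  trans (cong (f ∧_) (∧-zeroʳ _)) (∧-zeroʳ f)

#tightGap-gap0 : ∀ m e → #tightGap m (suc e) 0 ≡ 0
#tightGap-gap0 m e = count-none _ (labelTree m) (λ {l} l∈ → tightGap-gap0 m l (labelTree-shape m l l∈) e)

desUncut<-everything : ∀ m l → Shape (suc m) l → ∀ D → (Label.lDes l ≡ᵇ D) ≡ hasDesUncut< D (suc m) (suc m) l
desUncut<-everything m (label d k f a) (inj₁ (refl , refl , refl , refl)) D rewrite n∸n≡0 m = sym (∧-identityʳ _)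
desUncut<-everything m (label d (suc (suc k)) f a) (inj₂ (_ , s≤s z≤n , s≤s (s≤s _) , _)) D =
  sym (trans (cong ((d ≡ᵇ D) ∧_) (<ᵇ-true (s≤s (m∸n≤m m k)))) (∧-identityʳ _))

#des≡ : ∀ m D → count (λ l → Label.lDes l ≡ᵇ D) (labelTree (suc m)) ≡ #desUncut< (suc m) D (suc m)
#des≡ m D = count-cong-local _ _ (labelTree (suc m)) (λ {l} l∈ → desUncut<-everything m l (labelTree-shape (suc m) l l∈) D)

tightGap<-everything : ∀ n l → Shape n l → ∀ D → ((Label.lDes l ≡ᵇ D) ∧ Label.lTight l) ≡ isTightGap< D (suc n) n l
tightGap<-everything n (label d k f a) (inj₁ (refl , refl , refl , refl)) D rewrite n∸n≡0 n =
  trans (∧-comm (0 ≡ᵇ D) true) (sym (∧-identityʳ (0 ≡ᵇ D)))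
tightGap<-everything n (label d k f a) (inj₂ (_ , s≤s {n = a′} z≤n , _ , _)) D =
  trans (∧-comm _ f) (cong (f ∧_) (sym (trans (cong ((d ≡ᵇ D) ∧_) (<ᵇ-true (s≤s (m∸n≤m n a′)))) (∧-identityʳ _))))

#tight-des≡ : ∀ n D → count (λ l → (Label.lDes l ≡ᵇ D) ∧ Label.lTight l) (labelTree n) ≡ #tightGap< n D (suc n)
#tight-des≡ n D = count-cong-local _ _ (labelTree n) (λ {l} l∈ → tightGap<-everything n l (labelTree-shape n l l∈) D)

-- Solving the recurrences.  binom is the binomial coefficient via Pascal's rule, which
-- is how the recurrences produce it; binom≡C identifies it with the library's _C_.
binom : ℕ → ℕ → ℕ
binom n zero = 1
binom zero (suc k) = 0
binom (suc n) (suc k) = binom n k + binom n (suc k)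

binom-vanish : ∀ n k → n < k → binom n k ≡ 0
binom-vanish zero (suc k) _ = refl
binom-vanish (suc n) (suc k) (s≤s n<k) = cong₂ _+_ (binom-vanish n k n<k) (binom-vanish n (suc k) (≤-trans n<k (n≤1+n k)))

binom-1 : ∀ n → binom n 1 ≡ n
binom-1 zero = refl
binom-1 (suc n) = cong suc (binom-1 n)

prefix-sum-step : ∀ P N a b x₀ x₁ x₂ → P + a * x₂ ≡ b * x₁ → N + a * x₁ ≡ b * x₀ →
  (P + N) + a * (x₁ + x₂) ≡ b * (x₀ + x₁)
prefix-sum-step P N a b x₀ x₁ x₂ e₁ e₂ = trans (regroup P N a x₁ x₂) (trans (cong₂ _+_ e₁ e₂) (factor b x₀ x₁))
  where
  regroup : ∀ P N a x₁ x₂ → (P + N) + a * (x₁ + x₂) ≡ (P + a * x₂) + (N + a * x₁)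
  regroup = solve-∀
  factor : ∀ b x₀ x₁ → b * x₁ + b * x₀ ≡ b * (x₀ + x₁)
  factor = solve-∀

pascal-sum-step : ∀ N P a′ a b y z → N + a * y ≡ b * z → P + a′ * y ≡ a * z →
  (N + P) + (a′ + a) * y ≡ (a + b) * z
pascal-sum-step N P a′ a b y z e₁ e₂ = trans (regroup N P a′ a y) (trans (cong₂ _+_ e₁ e₂) (factor a b z))
  where
  regroup : ∀ N P a′ a y → (N + P) + (a′ + a) * y ≡ (N + a * y) + (P + a′ * y)
  regroup = solve-∀
  factor : ∀ a b z → b * z + a * z ≡ (a + b) * z
  factor = solve-∀

-- closed forms for the counts by descents and non-cuts, proved by a joint induction on
-- the level (desUncut-step) and, within a level, on the bound w (desUncut<-from)
DesUncutLaw : ℕ → ℕ → ℕ → Set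
DesUncutLaw m e w = #desUncut (suc m) (suc e) (suc w) + binom m e * binom w (suc e) ≡ binom m (suc e) * binom w e

DesUncut<Law : ℕ → ℕ → ℕ → Set
DesUncut<Law m e w = #desUncut< (suc m) (suc e) (suc w) + binom m e * binom w (suc (suc e)) ≡ binom m (suc e) * binom w (suc e)

#desUncut<-zero : ∀ m D → #desUncut< m D 0 ≡ 0
#desUncut<-zero m D = count-none _ (labelTree m) (λ _ → ∧-zeroʳ _)

#tightGap<-zero : ∀ m D → #tightGap< m D 0 ≡ 0
#tightGap<-zero m D = count-none _ (labelTree m) (λ {l} _ → trans (cong (Label.lTight l ∧_) (∧-zeroʳ _)) (∧-zeroʳ _))

desUncut<-from : ∀ m → (∀ e w → w ≤ m → DesUncutLaw m e w) → ∀ e w → w ≤ suc m → DesUncut<Law m e w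
desUncut<-from m law e zero _ =
  trans (cong (_+ binom m e * 0) (trans (#desUncut<-suc (suc m) (suc e) 0)
                                        (cong₂ _+_ (#desUncut<-zero (suc m) (suc e)) (#desUncut-uncut0 (suc m) e))))
    (trans (*-zeroʳ (binom m e)) (sym (*-zeroʳ (binom m (suc e)))))
desUncut<-from m law e (suc w) (s≤s w≤m) =
  trans (cong (_+ binom m e * binom (suc w) (suc (suc e))) (#desUncut<-suc (suc m) (suc e) (suc w)))
    (prefix-sum-step _ _ (binom m e) (binom m (suc e)) (binom w e) (binom w (suc e)) (binom w (suc (suc e)))
      (desUncut<-from m law e w (≤-trans w≤m (n≤1+n m))) (law e w w≤m))

desUncut-step : ∀ m → (∀ e w → w ≤ m → DesUncutLaw m e w) → (∀ e w → w ≤ suc m → DesUncut<Law m e w) →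
  ∀ e w → w ≤ suc m → DesUncutLaw (suc m) e w
desUncut-step m law law< e w w≤ with w ≤? m
desUncut-step m law law< zero w w≤ | yes w≤m =
  trans (cong (_+ 1 * binom w 1) (trans (#desUncut-rec (suc m) zero (suc w))
          (cong (λ t → #desUncut (suc m) 1 (suc w) + (if t then #desUncut< (suc m) 0 (suc w) else 0)) (≤ᵇ-true (s≤s w≤m)))))
    (trans (cong (λ z → #desUncut (suc m) 1 (suc w) + z + 1 * binom w 1) (#desUncut<-des0 (suc m) w))
      (trans (suc-out (#desUncut (suc m) 1 (suc w)) (binom w 1)) (cong suc (law zero w w≤m))))
  where
  suc-out : ∀ N y → N + 1 + 1 * y ≡ suc (N + 1 * y)
  suc-out = solve-∀
desUncut-step m law law< (suc e) w w≤ | yes w≤m =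
  trans (cong (_+ binom (suc m) (suc e) * binom w (suc (suc e))) (trans (#desUncut-rec (suc m) (suc e) (suc w))
          (cong (λ t → #desUncut (suc m) (suc (suc e)) (suc w) + (if t then #desUncut< (suc m) (suc e) (suc w) else 0))
                (≤ᵇ-true (s≤s w≤m)))))
    (pascal-sum-step _ _ (binom m e) (binom m (suc e)) (binom m (suc (suc e))) (binom w (suc (suc e))) (binom w (suc e))
      (law (suc e) w w≤m) (law< e w w≤))
desUncut-step m law law< e w w≤ | no w≰m with ≤-antisym w≤ (≰⇒> w≰m)
... | refl =
  trans (cong (_+ binom (suc m) e * binom (suc m) (suc e))
          (trans (#desUncut-rec (suc m) e (suc (suc m)))
            (trans (cong (λ t → #desUncut (suc m) (suc e) (suc (suc m)) + (if t then #desUncut< (suc m) e (suc (suc m)) else 0))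
                         (≤ᵇ-false {suc (suc m)} {suc m} (λ le → 1+n≰n (≤-pred le))))
              (trans (+-identityʳ _) (#desUncut-uncut-top (suc m) (suc e))))))
    (*-comm (binom (suc m) e) (binom (suc m) (suc e)))

desUncut-law : ∀ m e w → w ≤ m → DesUncutLaw m e w
desUncut-law zero e zero _ = *-zeroʳ (binom 0 e)
desUncut-law (suc m) = desUncut-step m (desUncut-law m) (desUncut<-from m (desUncut-law m))

desUncut<-law : ∀ m e w → w ≤ suc m → DesUncut<Law m e w
desUncut<-law m = desUncut<-from m (desUncut-law m)

TightGapLaw : ℕ → ℕ → ℕ → Set
TightGapLaw m e b = #tightGap m (suc e) (suc b) ≡ binom (b + e) (suc (e + e))

TightGap<Law : ℕ → ℕ → ℕ → Set
TightGap<Law m e b = #tightGap< m (suc e) (suc b) ≡ binom (b + e) (suc (suc (e + e)))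

tightGap<-from : ∀ m → (∀ e b → b < m → TightGapLaw m e b) → ∀ e b → b ≤ m → TightGap<Law m e b
tightGap<-from m law e zero _ =
  trans (#tightGap<-suc m (suc e) 0) (trans (cong₂ _+_ (#tightGap<-zero m (suc e)) (#tightGap-gap0 m e))
    (sym (binom-vanish e (suc (suc (e + e))) (s≤s (≤-trans (m≤m+n e e) (n≤1+n _))))))
tightGap<-from m law e (suc b) b<m =
  trans (#tightGap<-suc m (suc e) (suc b))
    (trans (cong₂ _+_ (tightGap<-from m law e b (≤-trans (n≤1+n b) b<m)) (law e b b<m))
      (+-comm (binom (b + e) (suc (suc (e + e)))) (binom (b + e) (suc (e + e)))))

tightGap-step : ∀ m → (∀ e b → b < m → TightGapLaw m e b) → (∀ e b → b ≤ m → TightGap<Law m e b) →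
  ∀ e b → b < suc m → TightGapLaw (suc m) e b
tightGap-step m law law< zero zero _ = trans (#tightGap-rec₁ m 0) (cong (_+ 0) (#tightGap-gap0 m 0))
tightGap-step m law law< zero (suc b) (s≤s b<m) =
  trans (#tightGap-rec₁ m (suc b))
    (trans (cong (λ t → #tightGap m 1 (suc b) + ind (true ∧ t)) (≤ᵇ-true b<m))
      (trans (cong (_+ 1) (law zero b b<m)) (+-comm (binom (b + 0) 1) 1)))
tightGap-step m law law< (suc e) zero _ =
  trans (#tightGap-rec₂ m e 0) (trans (cong₂ _+_ (#tightGap-gap0 m (suc e)) (law< e 0 z≤n))
    (trans (binom-vanish e (suc (suc (e + e))) (s≤s (≤-trans (m≤m+n e e) (n≤1+n _))))
      (sym (binom-vanish (suc e) (suc (suc e + suc e)) (s≤s (s≤s (m≤m+n e (suc e))))))))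
tightGap-step m law law< (suc e) (suc b) (s≤s b<m) =
  trans (#tightGap-rec₂ m e (suc b))
    (trans (cong (λ t → #tightGap m (suc (suc e)) (suc b) + (if t then #tightGap< m (suc e) (suc (suc b)) else 0))
                 (≤ᵇ-true b<m))
      (trans (cong₂ _+_ (law (suc e) b b<m)
                        (trans (law< e (suc b) b<m) (cong₂ binom (sym (+-suc b e)) (cong suc (sym (+-suc e e))))))
        (+-comm (binom (b + suc e) (suc (suc e + suc e))) (binom (b + suc e) (suc e + suc e)))))

tightGap-law : ∀ m e b → b < m → TightGapLaw m e b
tightGap-law (suc m) = tightGap-step m (tightGap-law m) (tightGap<-from m (tightGap-law m))

tightGap<-law : ∀ m e b → b ≤ m → TightGap<Law m e b
tightGap<-law m = tightGap<-from m (tightGap-law m)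

binom-absorb : ∀ n k → suc k * binom (suc n) (suc k) ≡ suc n * binom n k
binom-absorb zero zero = refl
binom-absorb zero (suc k) = *-zeroʳ (suc (suc k))
binom-absorb (suc n) zero = trans (+-identityʳ _) (trans (binom-1 (suc (suc n))) (sym (*-identityʳ _)))
binom-absorb (suc n) (suc k) =
  trans (expand k (binom (suc n) (suc k)) (binom (suc n) (suc (suc k))))
    (trans (cong₂ (λ p q → binom (suc n) (suc k) + p + q) (binom-absorb n k) (binom-absorb n (suc k)))
      (collect n (binom n k) (binom n (suc k))))
  where
  expand : ∀ k X Y → suc (suc k) * (X + Y) ≡ X + suc k * X + suc (suc k) * Y
  expand = solve-∀
  collect : ∀ n P Q → (P + Q) + suc n * P + suc n * Q ≡ suc (suc n) * (P + Q)
  collect = solve-∀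

-- The Narayana product formula: if T + a c = b² for consecutive binomials a, b, c of
-- row m, then (m+1) T is the product of consecutive binomials of row m+1.  The hypotheses
-- (e+1)(a+b) = x a and (e+2)(b+c) = x b are the absorption identities for x = m+1.
narayana-algebra : ∀ x e a b c T → suc e * (a + b) ≡ x * a → suc (suc e) * (b + c) ≡ x * b →
  T + a * c ≡ b * b → x * T ≡ (a + b) * (b + c)
narayana-algebra x e a b c T absorb₁ absorb₂ defect = *-cancelˡ-≡ (x * T) ((a + b) * (b + c)) (j * suc j) scaled
  where
  j : ℕ
  j = suc e
  K : ℕ
  K = suc j * b * (j * a)
  bb+K : j * suc j * (b * b) + K ≡ x * a * b + j * suc j * (a * c) + K
  bb+K = begin
      j * suc j * (b * b) + K
        ≡⟨ q₁ j a b ⟩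
      suc j * b * (j * (a + b))
        ≡⟨ cong (suc j * b *_) absorb₁ ⟩
      suc j * b * (x * a)
        ≡⟨ q₂ j x a b ⟩
      x * a * b + j * a * (x * b)
        ≡⟨ cong (λ z → x * a * b + j * a * z) (sym absorb₂) ⟩
      x * a * b + j * a * (suc j * (b + c))
        ≡⟨ q₃ j x a b c ⟩
      x * a * b + j * suc j * (a * c) + K ∎
    where
    open ≡-Reasoning
    q₁ : ∀ j a b → j * suc j * (b * b) + suc j * b * (j * a) ≡ suc j * b * (j * (a + b))
    q₁ = solve-∀
    q₂ : ∀ j x a b → suc j * b * (x * a) ≡ x * a * b + j * a * (x * b)
    q₂ = solve-∀
    q₃ : ∀ j x a b c → x * a * b + j * a * (suc j * (b + c)) ≡ x * a * b + j * suc j * (a * c) + suc j * b * (j * a)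
    q₃ = solve-∀
  jT : j * suc j * T ≡ x * a * b
  jT = +-cancelʳ-≡ (j * suc j * (a * c)) _ _
         (trans (sym (*-distribˡ-+ (j * suc j) T (a * c)))
                (trans (cong (j * suc j *_) defect) (+-cancelʳ-≡ K _ _ bb+K)))
  scaled : j * suc j * (x * T) ≡ j * suc j * ((a + b) * (b + c))
  scaled = begin
      j * suc j * (x * T)
        ≡⟨ q₄ j x T ⟩
      x * (j * suc j * T)
        ≡⟨ cong (x *_) jT ⟩
      x * (x * a * b)
        ≡⟨ q₅ x a b ⟩
      (x * a) * (x * b)
        ≡⟨ cong₂ _*_ (sym absorb₁) (sym absorb₂) ⟩
      (j * (a + b)) * (suc j * (b + c))
        ≡⟨ q₆ j a b c ⟩
      j * suc j * ((a + b) * (b + c)) ∎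
    where
    open ≡-Reasoning
    q₄ : ∀ j x T → j * suc j * (x * T) ≡ x * (j * suc j * T)
    q₄ = solve-∀
    q₅ : ∀ x a b → x * (x * a * b) ≡ (x * a) * (x * b)
    q₅ = solve-∀
    q₆ : ∀ j a b c → (j * (a + b)) * (suc j * (b + c)) ≡ j * suc j * ((a + b) * (b + c))
    q₆ = solve-∀

narayana : ∀ m e T → T + binom m e * binom m (suc (suc e)) ≡ binom m (suc e) * binom m (suc e) →
  suc m * T ≡ binom (suc m) (suc e) * binom (suc m) (suc (suc e))
narayana m e T defect =
  narayana-algebra (suc m) e (binom m e) (binom m (suc e)) (binom m (suc (suc e))) T
    (binom-absorb m e) (binom-absorb m (suc e)) defect

binom≡C : ∀ n k → binom n k ≡ n C k
binom≡C n zero = refl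
binom≡C zero (suc k) = sym (k>n⇒nCk≡0 {0} {suc k} (s≤s z≤n))
binom≡C (suc n) (suc k) = trans (cong₂ _+_ (binom≡C n k) (binom≡C n (suc k))) (nCk+nC[k+1]≡[n+1]C[k+1] n k)

count-tight : ∀ n e → count (λ l → (Label.lDes l ≡ᵇ suc e) ∧ Label.lTight l) (labelTree n)
  ≡ (n + suc e ∸ 1) C (2 * suc e)
count-tight n e = begin
    count (λ l → (Label.lDes l ≡ᵇ suc e) ∧ Label.lTight l) (labelTree n)
      ≡⟨ #tight-des≡ n (suc e) ⟩
    #tightGap< n (suc e) (suc n)
      ≡⟨ tightGap<-law n e n ≤-refl ⟩
    binom (n + e) (suc (suc (e + e)))
      ≡⟨ binom≡C (n + e) (suc (suc (e + e))) ⟩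
    (n + e) C suc (suc (e + e))
      ≡⟨ cong₂ _C_ (sym (cong (_∸ 1) (+-suc n e))) (cong suc (trans (sym (+-suc e e)) (cong (e +_) (sym (+-identityʳ (suc e)))))) ⟩
    (n + suc e ∸ 1) C (2 * suc e) ∎
  where open ≡-Reasoning

count-des : ∀ m e → suc m * count (λ l → Label.lDes l ≡ᵇ suc e) (labelTree (suc m))
  ≡ (suc m C suc e) * (suc m C suc (suc e))
count-des m e = begin
    suc m * count (λ l → Label.lDes l ≡ᵇ suc e) (labelTree (suc m))
      ≡⟨ cong (suc m *_) (#des≡ m (suc e)) ⟩
    suc m * #desUncut< (suc m) (suc e) (suc m)
      ≡⟨ narayana m e _ (desUncut<-law m e m (n≤1+n m)) ⟩
    binom (suc m) (suc e) * binom (suc m) (suc (suc e))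
      ≡⟨ cong₂ _*_ (binom≡C (suc m) (suc e)) (binom≡C (suc m) (suc (suc e))) ⟩
    (suc m C suc e) * (suc m C suc (suc e)) ∎
  where open ≡-Reasoning

count-split : ∀ {A : Set} (p r : A → Bool) xs →
  count (λ x → p x ∧ not (r x)) xs + count (λ x → p x ∧ r x) xs ≡ count p xs
count-split p r [] = refl
count-split p r (x ∷ xs) = trans (ind-split (p x) (r x) _ _) (cong (ind (p x) +_) (count-split p r xs))
  where
  ind-split : ∀ a b X Y → ind (a ∧ not b) + X + (ind (a ∧ b) + Y) ≡ ind a + (X + Y)
  ind-split false b X Y = refl
  ind-split true false X Y = refl
  ind-split true true X Y = +-suc X Y

length-filter-count : ∀ {P : List ℕ → Set} (P? : Decidable P) (q : List ℕ → Bool) xs →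
  (∀ {x} → x ∈ xs → Iff (P x) (T (q x))) → length (filter P? xs) ≡ count q xs
length-filter-count P? q [] _ = refl
length-filter-count P? q (x ∷ xs) P⇔q with P? x
... | yes px rewrite T⇒≡true (proj₁ (P⇔q (here refl)) px) = cong suc (length-filter-count P? q xs (P⇔q ∘ there))
... | no ¬px rewrite ¬T⇒≡false (λ t → ¬px (proj₂ (P⇔q (here refl)) t)) = length-filter-count P? q xs (P⇔q ∘ there)

#perms231-by-label : ∀ n {Q : List ℕ → Set} (Q? : Decidable Q) (q : Label → Bool) →
  (∀ {σ} → σ ∈ perms231 n → Iff (Q σ) (T (q (labelOf σ)))) →
  length (filter Q? (perms231 n)) ≡ count q (labelTree n)
#perms231-by-label n Q? q Q⇔q = trans (length-filter-count Q? (q ∘ labelOf) (perms231 n) Q⇔q)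
  (trans (sym (count-map q labelOf (perms231 n))) (cong (count q) (labels-perms231 n)))

perms231-HasCount : ∀ n {Q : List ℕ → Set} (Q? : Decidable Q) →
  HasCount (λ σ → InS231 n σ × Q σ) (length (filter Q? (perms231 n)))
perms231-HasCount n Q? = filter Q? (perms231 n) , filter⁺ Q? (perms231-unique n) , refl , λ σ → mk⇔
  (λ σ∈ → let (σ∈′ , qσ) = ∈-filter⁻ Q? {xs = perms231 n} σ∈
              (perm , av) = perms231-sound n σ σ∈′ in
          (perm , Av231⇒Avoids231 σ av) , qσ)
  (λ ((perm , av) , qσ) → ∈-filter⁺ Q? (perms231-complete n σ (perm , Avoids231⇒Av231 σ av)) qσ)

tight⇔label : ∀ j σ → Iff (des σ ≡ j × maxdrop σ ≡ j) (T ((des σ ≡ᵇ j) ∧ (maxdrop σ ≡ᵇ des σ)))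
tight⇔label j σ =
  (λ (des≡ , md≡) → T∧ (≡⇒≡ᵇ _ _ des≡) (≡⇒≡ᵇ _ _ (trans md≡ (sym des≡)))) ,
  (λ t → let des≡ = ≡ᵇ⇒≡ _ _ (T∧₁ t) in des≡ , trans (≡ᵇ⇒≡ _ _ (T∧₂ t)) des≡)

-- since maxdrop ≤ des on S_n(231), "not tight" means maxdrop ≤ des − 1
loose⇔label : ∀ n e {σ} → σ ∈ perms231 n →
  Iff (des σ ≡ suc e × maxdrop σ ≤ e) (T ((des σ ≡ᵇ suc e) ∧ not (maxdrop σ ≡ᵇ des σ)))
loose⇔label n e {σ} σ∈ =
  (λ (des≡ , md≤) → T∧ (≡⇒≡ᵇ _ _ des≡)
     (subst T (sym (cong not (≡ᵇ-false (λ md≡ → 1+n≰n (subst (_≤ e) (trans md≡ des≡) md≤))))) _)) ,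
  (λ t → let des≡ = ≡ᵇ⇒≡ _ _ (T∧₁ t)
             md≢ = λ md≡ → subst T (cong not (T⇒≡true (≡⇒≡ᵇ _ _ md≡))) (T∧₂ t) in
         des≡ , ≤-pred (subst (maxdrop σ <_) des≡ (≤∧≢⇒< (maxdrop≤des n σ σ∈) md≢)))

theorem13 : (n j : ℕ) → n ≥ 1 → j ≥ 1 →
    HasCount (λ σ → InS231 n σ × des σ ≡ j × maxdrop σ ≡ j) ((n + j ∸ 1) C (2 * j))
    × Σ ℕ (λ N → HasCount (λ σ → InS231 n σ × des σ ≡ j × maxdrop σ ≤ j ∸ 1) N
    × n * (N + (n + j ∸ 1) C (2 * j)) ≡ (n C j) * (n C suc j))
theorem13 (suc m) (suc e) _ _ =
  subst (HasCount _) #tight (perms231-HasCount n Tight?) ,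
  #loose , perms231-HasCount n Loose? , total
  where
  n : ℕ
  n = suc m
  j : ℕ
  j = suc e
  Tight? : Decidable (λ σ → des σ ≡ j × maxdrop σ ≡ j)
  Tight? σ = (des σ ≟ j) ×-dec (maxdrop σ ≟ j)
  Loose? : Decidable (λ σ → des σ ≡ j × maxdrop σ ≤ e)
  Loose? σ = (des σ ≟ j) ×-dec (maxdrop σ ≤? e)
  hasDes : Label → Bool
  hasDes l = Label.lDes l ≡ᵇ j
  #tight : length (filter Tight? (perms231 n)) ≡ (n + j ∸ 1) C (2 * j)
  #tight = trans (#perms231-by-label n Tight? _ (λ {σ} _ → tight⇔label j σ)) (count-tight n e)
  #loose : ℕ
  #loose = length (filter Loose? (perms231 n))
  total : n * (#loose + (n + j ∸ 1) C (2 * j)) ≡ (n C j) * (n C suc j)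
  total = begin
      n * (#loose + (n + j ∸ 1) C (2 * j))
        ≡⟨ cong (λ t → n * (#loose + t)) (sym #tight) ⟩
      n * (#loose + length (filter Tight? (perms231 n)))
        ≡⟨ cong₂ (λ a b → n * (a + b)) (#perms231-by-label n Loose? _ (loose⇔label n e))
                                      (#perms231-by-label n Tight? _ (λ {σ} _ → tight⇔label j σ)) ⟩
      n * (count (λ l → hasDes l ∧ not (Label.lTight l)) (labelTree n)
           + count (λ l → hasDes l ∧ Label.lTight l) (labelTree n))
        ≡⟨ cong (n *_) (count-split hasDes Label.lTight (labelTree n)) ⟩
      n * count hasDes (labelTree n)
        ≡⟨ count-des m e ⟩
      (n C j) * (n C suc j) ∎
    where open ≡-Reasoning
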